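{- Let $K\ge 3$ be an integer. The number $p(K)$ of three-pile zero-nim positions with total number of objects at most $K$ — i.e., the number of multisets $\{x,y,z\}$ of positive integers with $x+y+z\le K$ and $x\oplus y\oplus z=0$ — is $$p(K)=\frac{1}{3}\sum_{S=3}^{K}\sum_{n=1}^{S-2} f(n,S-n) = \sum_{S=3}^{K} q(S),$$ where $q(S)=\frac13\sum_{n=1}^{S-2} f(n,S-n)$ and, for integers $s$ and $x\ge 0$, $$f(s,x)=\begin{cases} 0 & \text{if } s-x \text{ is odd},\\ 0 & \text{if } s-x \text{ is even and for some } i \text{ the } i\text{th binary digit of } \tfrac{s-x}{2} \text{ and of } x \text{ both equal } 1,\\ 2^{g(x)-1}-1 & \text{otherwise, if } s=x,\\ 2^{g(x)-1} & \text{otherwise (} s-x \text{ even)}\end{cases}$$ (the cases checked in the order listed).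
   Context: $\oplus$ denotes bitwise exclusive-or. A zero-nim position is a tuple of pile sizes whose bitwise XOR is $0$. For a nonnegative integer $n$, $g(n)$ denotes the number of $1$s in the binary expansion of $n$. Binary digits of a negative integer are taken in two's complement. -}

module Defs where

open import Data.Bool using (Bool; true; false; not; _∧_; _∨_; if_then_else_)
open import Data.Nat using (ℕ; zero; suc; _+_; _*_; _∸_; _^_; _≡ᵇ_; _≤ᵇ_)
open import Data.Nat.DivMod using (_/_; _%_)
open import Data.Integer as ℤ using (ℤ; +_; -[1+_])
open import Data.List using (List; []; _∷_; map; upTo; concatMap; filterᵇ; length; foldr)
open import Data.Nat.ListAction using (sum)
open import Data.Bool.ListAction using (any)
open import Relation.Nullary using (yes; no)
open import Data.Product using (_×_; _,_)
open import Data.Rational as ℚ using (ℚ)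

bit : ℕ → ℕ → Bool
bit zero    n = n % 2 ≡ᵇ 1
bit (suc i) n = bit i (n / 2)

-- i-th binary digit of an integer, in two's complement:
-- -(k+1) is the bitwise complement of k
bitℤ : ℕ → ℤ → Bool
bitℤ i (+ n)     = bit i n
bitℤ i -[1+ k ]  = not (bit i k)

-- bitwise xor on ℕ (fuel-based; fuel a + b exceeds the bit length)
xorF : ℕ → ℕ → ℕ → ℕ
xorF zero     a b = 0
xorF (suc fu) a b =
  (if (a % 2 ≡ᵇ b % 2) then 0 else 1) + 2 * xorF fu (a / 2) (b / 2)

infixl 6 _⊕_
_⊕_ : ℕ → ℕ → ℕ
a ⊕ b = xorF (a + b) a b

-- g(n) = number of 1s in the binary expansion of n (fuel n suffices)
popF : ℕ → ℕ → ℕ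
popF zero     n = 0
popF (suc fu) n = n % 2 + popF fu (n / 2)

g : ℕ → ℕ
g n = popF n n

-- exact halving of an (even) integer (floor division by 2)
halfℤ : ℤ → ℤ
halfℤ (+ n)    = + (n / 2)
halfℤ -[1+ k ] = -[1+ (k / 2) ]

oddℤ : ℤ → Bool
oddℤ d = ℤ.∣ d ∣ % 2 ≡ᵇ 1

-- "for some i, the i-th binary digits of h and of x are both 1".
-- Bits of x at positions ≥ x are all 0 (x < 2^x), so i ≤ x suffices.
clash : ℤ → ℕ → Bool
clash h x = any (λ i → bitℤ i h ∧ bit i x) (upTo (suc x))

f : ℤ → ℕ → ℕ
f s x with oddℤ (s ℤ.- + x)
... | true  = 0
... | false with clash (halfℤ (s ℤ.- + x)) x
...   | true  = 0
...   | false with s ℤ.≟ + x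
...     | yes _ = 2 ^ (g x ∸ 1) ∸ 1
...     | no _ = 2 ^ (g x ∸ 1)

range : ℕ → ℕ → List ℕ
range a k = map (_+ a) (upTo k)

-- multisets {x,y,z} of positive integers, encoded as sorted triples x ≤ y ≤ z,
-- with x + y + z ≤ K and x ⊕ y ⊕ z = 0
triples : ℕ → List (ℕ × ℕ × ℕ)
triples K = concatMap (λ x → concatMap (λ y → map (λ z → (x , y , z)) (range 1 K)) (range 1 K)) (range 1 K)

isZeroNim : ℕ → ℕ × ℕ × ℕ → Bool
isZeroNim K (x , y , z) =
  (x ≤ᵇ y) ∧ (y ≤ᵇ z) ∧ (x + y + z ≤ᵇ K) ∧ (x ⊕ y ⊕ z ≡ᵇ 0)

p : ℕ → ℕ
p K = length (filterᵇ (isZeroNim K) (triples K))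

innerSum : ℕ → ℕ
innerSum S = sum (map (λ n → f (+ (S ∸ n)) n) (range 1 (S ∸ 2)))

doubleSum : ℕ → ℕ
doubleSum K = sum (map innerSum (range 3 (K ∸ 2)))

third : ℚ
third = (+ 1) ℚ./ 3

q : ℕ → ℚ
q S = third ℚ.* ((+ innerSum S) ℚ./ 1)

sumℚ : List ℚ → ℚ
sumℚ = foldr ℚ._+_ ℚ.0ℚ

-- Since y + z = (y ⊕ z) + 2 (y ∧ z), the ordered pairs (y , z) with y ⊕ z = n and
-- y + z = s exist only if s = n + 2 h where h and n share no binary digit, and then
-- there are 2 ^ g n of them, one for each way of distributing the digits of n
-- between y and z; this count is computed by recursion on the lowest digits.
-- For n ≥ 1 the case y = z is impossible and y = 0 occurs only when s = n, so
-- f (s , n) counts the pairs 0 < y < z with y + z = s and y ⊕ z = n.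
-- The entries of a zero-nim triple of positive integers are distinct, so choosing
-- one entry x and listing the other two increasingly counts each triple three
-- times; summing over x and the total S gives 3 p K = Σ_S Σ_x f (S - x , x).

module Submission where

open import Defs
open import Data.Bool using (Bool; true; false; not; _∧_; _∨_; if_then_else_; T)
open import Data.Bool.Properties using (∧-zeroʳ; ∧-identityʳ; T-∧)
open import Function.Bundles using (Equivalence)
open import Data.Empty using (⊥-elim)
open import Data.Nat using (ℕ; zero; suc; _+_; _*_; _∸_; _^_; _≡ᵇ_; _≤ᵇ_; _<ᵇ_; _≤_; _<_; _≥_; z≤n; s≤s)
open import Data.Nat.Divisibility using (∣1⇒≡1)
open import Data.Rational as ℚ using (ℚ; mkℚ)
import Data.Rational.Properties as ℚP
open import Data.Nat.DivMod using (_/_; _%_; m≡m%n+[m/n]*n; m%n<n; [m+kn]%n≡m%n; m<n⇒m%n≡m; m<n⇒m/n≡0; m*n%n≡0; m*n/n≡m; +-distrib-/; m/n<m; m/n≤m; %-congˡ; /-congˡ)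
open import Data.Nat.Properties
open import Relation.Binary.PropositionalEquality
open import Relation.Binary.Definitions using (tri<; tri≈; tri>)
open import Data.Product using (Σ; _,_; _×_; proj₂)
open import Data.Sum using (_⊎_; inj₁; inj₂)
open import Data.Nat.Tactic.RingSolver using (solve-∀)
open import Data.List using (List; []; _∷_; _++_; map; upTo; applyUpTo; concatMap; filterᵇ; length)
open import Data.List.Properties using (map-∘; map-++)
open import Data.Nat.ListAction using (sum)
open import Data.Nat.ListAction.Properties using (sum-++)
open import Data.Bool.ListAction using (any)
import Data.Integer as ℤ
import Data.Integer.Properties as ℤP
open import Relation.Nullary using (does; yes; no)

data Parity (a : ℕ) : Set where
  even : ∀ k → a ≡ 2 * k → Parity a
  odd  : ∀ k → a ≡ 1 + 2 * k → Parity a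

m%2+2*[m/2]≡m : ∀ m → m % 2 + 2 * (m / 2) ≡ m
m%2+2*[m/2]≡m m = trans (cong (m % 2 +_) (*-comm 2 (m / 2))) (sym (m≡m%n+[m/n]*n m 2))

m%2≤1 : ∀ m → m % 2 ≤ 1
m%2≤1 m = ≤-pred (m%n<n m 2)

parity : ∀ a → Parity a
parity a with a % 2 | m%2≤1 a | m%2+2*[m/2]≡m a
... | 0           | _           | e = even (a / 2) (sym e)
... | 1           | _           | e = odd (a / 2) (sym e)
... | suc (suc _) | s≤s ()      | _

[c+2k]%2≡c : ∀ c k → c ≤ 1 → (c + 2 * k) % 2 ≡ c
[c+2k]%2≡c c k c≤1 = begin
  (c + 2 * k) % 2 ≡⟨ %-congˡ (cong (c +_) (*-comm 2 k)) ⟩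
  (c + k * 2) % 2 ≡⟨ [m+kn]%n≡m%n c k 2 ⟩
  c % 2           ≡⟨ m<n⇒m%n≡m (s≤s c≤1) ⟩
  c               ∎
  where open ≡-Reasoning

[c+2k]/2≡k : ∀ c k → c ≤ 1 → (c + 2 * k) / 2 ≡ k
[c+2k]/2≡k c k c≤1 = begin
  (c + 2 * k) / 2   ≡⟨ /-congˡ (cong (c +_) (*-comm 2 k)) ⟩
  (c + k * 2) / 2   ≡⟨ +-distrib-/ c (k * 2) remainders<2 ⟩
  c / 2 + k * 2 / 2 ≡⟨ cong₂ _+_ (m<n⇒m/n≡0 (s≤s c≤1)) (m*n/n≡m k 2) ⟩
  k                 ∎
  where
  open ≡-Reasoning
  remainders<2 : c % 2 + (k * 2) % 2 < 2
  remainders<2 = subst (λ r → c % 2 + r < 2) (sym (m*n%n≡0 k 2)) (subst (_< 2) (sym (+-identityʳ (c % 2))) (m%n<n c 2))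

/2≤ : ∀ {a l} → a ≤ suc l → a / 2 ≤ l
/2≤ {zero}  _   = z≤n
/2≤ {suc a} a≤l = ≤-pred (≤-trans (m/n<m (suc a) 2 (s≤s (s≤s z≤n))) a≤l)

/2+/2≤ : ∀ a b {l} → a + b ≤ suc l → a / 2 + b / 2 ≤ l
/2+/2≤ zero    b a+b≤l = /2≤ a+b≤l
/2+/2≤ (suc a) b a+b≤l = ≤-pred (≤-trans (+-mono-<-≤ (m/n<m (suc a) 2 (s≤s (s≤s z≤n))) (m/n≤m b 2)) a+b≤l)

halving-ind₂ : (P : ℕ → ℕ → Set) → P 0 0 → (∀ a b → P (a / 2) (b / 2) → P a b) → ∀ a b → P a b
halving-ind₂ P base step a b = go (a + b) a b ≤-refl
  where
  go : ∀ N a b → a + b ≤ N → P a b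
  go zero    a b a+b≤0 rewrite n≤0⇒n≡0 (m+n≤o⇒m≤o a a+b≤0) | n≤0⇒n≡0 (m+n≤o⇒n≤o a a+b≤0) = base
  go (suc N) a b a+b≤N = step a b (go N (a / 2) (b / 2) (/2+/2≤ a b a+b≤N))

1+2a≢2b : ∀ a b → 1 + 2 * a ≢ 2 * b
1+2a≢2b a b eq = 1≢0 (trans (sym ([c+2k]%2≡c 1 a (s≤s z≤n))) (trans (%-congˡ eq) ([c+2k]%2≡c 0 b z≤n)))
  where
  1≢0 : 1 ≢ 0
  1≢0 ()

halve-bound : ∀ c {t M} → c + 2 * t < 2 * M → t < M
halve-bound c {t} {M} lt = *-cancelˡ-< 2 t M (≤-<-trans (m≤n+m (2 * t) c) lt)

n<2^n : ∀ n → n < 2 ^ n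
n<2^n zero    = s≤s z≤n
n<2^n (suc n) = subst (_≤ 2 ^ suc n) (+-comm (suc n) 1) (+-mono-≤ (n<2^n n) (≤-trans (m^n>0 2 n) (m≤m+n (2 ^ n) 0)))

𝟙 : Bool → ℕ
𝟙 true  = 1
𝟙 false = 0

𝟙-∧ : ∀ a b → 𝟙 (a ∧ b) ≡ 𝟙 a * 𝟙 b
𝟙-∧ false b     = refl
𝟙-∧ true  false = refl
𝟙-∧ true  true  = refl

∧-interchange : ∀ a b c d → (a ∧ b) ∧ (c ∧ d) ≡ (a ∧ c) ∧ (b ∧ d)
∧-interchange false b c     d = refl
∧-interchange true  b false d = ∧-zeroʳ b
∧-interchange true  b true  d = refl

T-ext : ∀ {a b} → (T a → T b) → (T b → T a) → a ≡ b
T-ext {false} {false} _ _ = refl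
T-ext {false} {true}  _ g = ⊥-elim (g _)
T-ext {true}  {false} f _ = ⊥-elim (f _)
T-ext {true}  {true}  _ _ = refl

≡ᵇ-refl : ∀ n → (n ≡ᵇ n) ≡ true
≡ᵇ-refl zero    = refl
≡ᵇ-refl (suc n) = ≡ᵇ-refl n

n+1+k≢ᵇn : ∀ n k → (n + suc k ≡ᵇ n) ≡ false
n+1+k≢ᵇn zero    k = refl
n+1+k≢ᵇn (suc n) k = n+1+k≢ᵇn n k

≡ᵇ-false : ∀ {a b} → a ≢ b → (a ≡ᵇ b) ≡ false
≡ᵇ-false {a} {b} a≢b = T-ext (λ t → ⊥-elim (a≢b (≡ᵇ⇒≡ a b t))) (λ ())

<ᵇ-true : ∀ {a b} → a < b → (a <ᵇ b) ≡ true
<ᵇ-true a<b = T-ext (λ _ → _) (λ _ → <⇒<ᵇ a<b)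

<ᵇ-false : ∀ {a b} → b ≤ a → (a <ᵇ b) ≡ false
<ᵇ-false {a} {b} b≤a = T-ext (λ t → ⊥-elim (<⇒≱ (<ᵇ⇒< a b t) b≤a)) (λ ())

≤ᵇ-true : ∀ {a b} → a ≤ b → (a ≤ᵇ b) ≡ true
≤ᵇ-true a≤b = T-ext (λ _ → _) (λ _ → ≤⇒≤ᵇ a≤b)

≤ᵇ-false : ∀ {a b} → b < a → (a ≤ᵇ b) ≡ false
≤ᵇ-false {a} {b} b<a = T-ext (λ t → ⊥-elim (<⇒≱ b<a (≤ᵇ⇒≤ a b t))) (λ ())

if-then-0 : ∀ {b} {x : ℕ} → b ≡ true → (if b then 0 else x) ≡ 0
if-then-0 refl = refl

≡ᵇ-digits : ∀ {c d} u v → c ≤ 1 → d ≤ 1 → (c + 2 * u ≡ᵇ d + 2 * v) ≡ ((c ≡ᵇ d) ∧ (u ≡ᵇ v))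
≡ᵇ-digits {c} {d} u v c≤1 d≤1 = T-ext to from
  where
  to : T (c + 2 * u ≡ᵇ d + 2 * v) → T ((c ≡ᵇ d) ∧ (u ≡ᵇ v))
  to t with ≡ᵇ⇒≡ (c + 2 * u) (d + 2 * v) t
  ... | eq with trans (sym ([c+2k]%2≡c c u c≤1)) (trans (%-congˡ eq) ([c+2k]%2≡c d v d≤1))
             | trans (sym ([c+2k]/2≡k c u c≤1)) (trans (/-congˡ eq) ([c+2k]/2≡k d v d≤1))
  ...   | refl | refl with c ≡ᵇ c | ≡⇒≡ᵇ c c refl | u ≡ᵇ u | ≡⇒≡ᵇ u u refl
  ...     | true | _ | true | _ = _
  from : T ((c ≡ᵇ d) ∧ (u ≡ᵇ v)) → T (c + 2 * u ≡ᵇ d + 2 * v)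
  from t with c ≡ᵇ d in c≡d | u ≡ᵇ v in u≡v
  ... | true | true = ≡⇒≡ᵇ _ _ (cong₂ (λ a b → a + 2 * b) (≡ᵇ⇒≡ c d (subst T (sym c≡d) _)) (≡ᵇ⇒≡ u v (subst T (sym u≡v) _)))

bitXor : ℕ → ℕ → ℕ
bitXor c d = if c ≡ᵇ d then 0 else 1

bitXor≤1 : ∀ c d → bitXor c d ≤ 1
bitXor≤1 c d with c ≡ᵇ d
... | true  = z≤n
... | false = s≤s z≤n

bitXor-comm : ∀ {c d} → c ≤ 1 → d ≤ 1 → bitXor c d ≡ bitXor d c
bitXor-comm z≤n       z≤n       = refl
bitXor-comm z≤n       (s≤s z≤n) = refl
bitXor-comm (s≤s z≤n) z≤n       = refl
bitXor-comm (s≤s z≤n) (s≤s z≤n) = refl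

bitXor-identityʳ : ∀ {c} → c ≤ 1 → bitXor c 0 ≡ c
bitXor-identityʳ z≤n       = refl
bitXor-identityʳ (s≤s z≤n) = refl

bitXor-cancelˡ : ∀ {c d} → c ≤ 1 → d ≤ 1 → bitXor c (bitXor c d) ≡ d
bitXor-cancelˡ z≤n       z≤n       = refl
bitXor-cancelˡ z≤n       (s≤s z≤n) = refl
bitXor-cancelˡ (s≤s z≤n) z≤n       = refl
bitXor-cancelˡ (s≤s z≤n) (s≤s z≤n) = refl

xorF-00 : ∀ L → xorF L 0 0 ≡ 0
xorF-00 zero    = refl
xorF-00 (suc L) = cong (2 *_) (xorF-00 L)

xorF-fuel : ∀ L L' a b → a ≤ L → b ≤ L → a ≤ L' → b ≤ L' → xorF L a b ≡ xorF L' a b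
xorF-fuel zero    L'       a b a≤0 b≤0 _ _ rewrite n≤0⇒n≡0 a≤0 | n≤0⇒n≡0 b≤0 = sym (xorF-00 L')
xorF-fuel (suc L) zero     a b _ _ a≤0 b≤0 rewrite n≤0⇒n≡0 a≤0 | n≤0⇒n≡0 b≤0 = xorF-00 (suc L)
xorF-fuel (suc L) (suc L') a b a≤L b≤L a≤L' b≤L' =
  cong (λ t → bitXor (a % 2) (b % 2) + 2 * t)
       (xorF-fuel L L' (a / 2) (b / 2) (/2≤ a≤L) (/2≤ b≤L) (/2≤ a≤L') (/2≤ b≤L'))

-- One step of a ⊕ b leaves fuel a + b ∸ 1, whereas a / 2 ⊕ b / 2 runs on a / 2 + b / 2.
⊕-unfold : ∀ a b → a ⊕ b ≡ bitXor (a % 2) (b % 2) + 2 * (a / 2 ⊕ b / 2)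
⊕-unfold zero    zero    = refl
⊕-unfold zero    (suc b) = cong (λ t → bitXor 0 (suc b % 2) + 2 * t)
  (xorF-fuel b _ _ _ z≤n (/2≤ ≤-refl) z≤n (m≤n+m (suc b / 2) 0))
⊕-unfold (suc a) b       = cong (λ t → bitXor (suc a % 2) (b % 2) + 2 * t)
  (xorF-fuel (a + b) _ _ _ (/2≤ (s≤s (m≤m+n a b))) (/2≤ (m≤n+m b (suc a))) (m≤m+n _ _) (m≤n+m _ _))

⊕-digits : ∀ {c d} y z → c ≤ 1 → d ≤ 1 → (c + 2 * y) ⊕ (d + 2 * z) ≡ bitXor c d + 2 * (y ⊕ z)
⊕-digits {c} {d} y z c≤1 d≤1 = begin
  (c + 2 * y) ⊕ (d + 2 * z)
    ≡⟨ ⊕-unfold (c + 2 * y) (d + 2 * z) ⟩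
  bitXor ((c + 2 * y) % 2) ((d + 2 * z) % 2) + 2 * ((c + 2 * y) / 2 ⊕ (d + 2 * z) / 2)
    ≡⟨ cong₂ (λ u v → bitXor u v + 2 * ((c + 2 * y) / 2 ⊕ (d + 2 * z) / 2)) ([c+2k]%2≡c c y c≤1) ([c+2k]%2≡c d z d≤1) ⟩
  bitXor c d + 2 * ((c + 2 * y) / 2 ⊕ (d + 2 * z) / 2)
    ≡⟨ cong₂ (λ u v → bitXor c d + 2 * (u ⊕ v)) ([c+2k]/2≡k c y c≤1) ([c+2k]/2≡k d z d≤1) ⟩
  bitXor c d + 2 * (y ⊕ z) ∎
  where open ≡-Reasoning

⊕-%2 : ∀ a b → (a ⊕ b) % 2 ≡ bitXor (a % 2) (b % 2)
⊕-%2 a b = trans (%-congˡ (⊕-unfold a b)) ([c+2k]%2≡c (bitXor (a % 2) (b % 2)) (a / 2 ⊕ b / 2) (bitXor≤1 (a % 2) (b % 2)))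

⊕-/2 : ∀ a b → (a ⊕ b) / 2 ≡ a / 2 ⊕ b / 2
⊕-/2 a b = trans (/-congˡ (⊕-unfold a b)) ([c+2k]/2≡k (bitXor (a % 2) (b % 2)) (a / 2 ⊕ b / 2) (bitXor≤1 (a % 2) (b % 2)))

⊕-comm : ∀ a b → a ⊕ b ≡ b ⊕ a
⊕-comm = halving-ind₂ (λ a b → a ⊕ b ≡ b ⊕ a) refl λ a b ih → begin
  a ⊕ b                                               ≡⟨ ⊕-unfold a b ⟩
  bitXor (a % 2) (b % 2) + 2 * (a / 2 ⊕ b / 2)        ≡⟨ cong₂ (λ u v → u + 2 * v) (bitXor-comm (m%2≤1 a) (m%2≤1 b)) ih ⟩
  bitXor (b % 2) (a % 2) + 2 * (b / 2 ⊕ a / 2)        ≡⟨ ⊕-unfold b a ⟨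
  b ⊕ a                                               ∎
  where open ≡-Reasoning

⊕-identityʳ : ∀ a → a ⊕ 0 ≡ a
⊕-identityʳ a = halving-ind₂ (λ a _ → a ⊕ 0 ≡ a) refl (λ a _ ih → begin
  a ⊕ 0                                   ≡⟨ ⊕-unfold a 0 ⟩
  bitXor (a % 2) 0 + 2 * (a / 2 ⊕ 0)      ≡⟨ cong₂ (λ u v → u + 2 * v) (bitXor-identityʳ (m%2≤1 a)) ih ⟩
  a % 2 + 2 * (a / 2)                     ≡⟨ m%2+2*[m/2]≡m a ⟩
  a                                       ∎) a 0
  where open ≡-Reasoning

⊕-identityˡ : ∀ a → 0 ⊕ a ≡ a
⊕-identityˡ a = trans (⊕-comm 0 a) (⊕-identityʳ a)

⊕-cancelˡ : ∀ a b → a ⊕ (a ⊕ b) ≡ b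
⊕-cancelˡ = halving-ind₂ (λ a b → a ⊕ (a ⊕ b) ≡ b) refl λ a b ih → begin
  a ⊕ (a ⊕ b)
    ≡⟨ ⊕-unfold a (a ⊕ b) ⟩
  bitXor (a % 2) ((a ⊕ b) % 2) + 2 * (a / 2 ⊕ (a ⊕ b) / 2)
    ≡⟨ cong₂ (λ u v → bitXor (a % 2) u + 2 * (a / 2 ⊕ v)) (⊕-%2 a b) (⊕-/2 a b) ⟩
  bitXor (a % 2) (bitXor (a % 2) (b % 2)) + 2 * (a / 2 ⊕ (a / 2 ⊕ b / 2))
    ≡⟨ cong₂ (λ u v → u + 2 * v) (bitXor-cancelˡ (m%2≤1 a) (m%2≤1 b)) ih ⟩
  b % 2 + 2 * (b / 2)
    ≡⟨ m%2+2*[m/2]≡m b ⟩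
  b ∎
  where open ≡-Reasoning

⊕-self : ∀ a → a ⊕ a ≡ 0
⊕-self a = subst (λ t → a ⊕ t ≡ 0) (⊕-identityʳ a) (⊕-cancelˡ a 0)

⊕-solveʳ : ∀ {a b c} → a ⊕ b ≡ c → a ⊕ c ≡ b
⊕-solveʳ {a} {b} refl = ⊕-cancelˡ a b

⊕≡0⇒≡ : ∀ {a b} → a ⊕ b ≡ 0 → a ≡ b
⊕≡0⇒≡ {a} {b} a⊕b≡0 = trans (sym (⊕-identityʳ a)) (⊕-solveʳ {a} {b} {0} a⊕b≡0)

⊕-rotate : ∀ a b {c} → a ⊕ b ≡ c → b ⊕ c ≡ a
⊕-rotate a b refl = trans (cong (b ⊕_) (⊕-comm a b)) (⊕-cancelˡ b a)

[a⊕b]⊕c≡0⇒a⊕b≡c : ∀ a b c → T ((a ⊕ b) ⊕ c ≡ᵇ 0) → a ⊕ b ≡ c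
[a⊕b]⊕c≡0⇒a⊕b≡c a b c t = ⊕≡0⇒≡ (≡ᵇ⇒≡ _ 0 t)

a⊕b≡c⇒[a⊕b]⊕c≡0 : ∀ a b {c} → a ⊕ b ≡ c → T ((a ⊕ b) ⊕ c ≡ᵇ 0)
a⊕b≡c⇒[a⊕b]⊕c≡0 a b {c} refl = ≡⇒≡ᵇ _ 0 (⊕-self c)

anyBelow : ℕ → (ℕ → Bool) → Bool
anyBelow zero    Q = false
anyBelow (suc L) Q = Q 0 ∨ anyBelow L (λ i → Q (suc i))

any-applyUpTo : ∀ L (P : ℕ → Bool) (σ : ℕ → ℕ) → any P (applyUpTo σ L) ≡ anyBelow L (λ i → P (σ i))
any-applyUpTo zero    P σ = refl
any-applyUpTo (suc L) P σ = cong (P (σ 0) ∨_) (any-applyUpTo L P (λ i → σ (suc i)))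

anyBelow-false : ∀ L Q → (∀ i → Q i ≡ false) → anyBelow L Q ≡ false
anyBelow-false zero    Q Q≡false = refl
anyBelow-false (suc L) Q Q≡false rewrite Q≡false 0 = anyBelow-false L _ (λ i → Q≡false (suc i))

bit-0 : ∀ i → bit i 0 ≡ false
bit-0 zero    = refl
bit-0 (suc i) = bit-0 i

bitwiseAny : (Bool → Bool → Bool) → ℕ → ℕ → ℕ → Bool
bitwiseAny _∙_ L a b = anyBelow L (λ i → bit i a ∙ bit i b)

-- The bits of b at positions ≥ b vanish.
bitwiseAny-fuel : ∀ _∙_ → (∀ x → x ∙ false ≡ false) →
  ∀ L L' a b → b ≤ L → b ≤ L' → bitwiseAny _∙_ L a b ≡ bitwiseAny _∙_ L' a b
bitwiseAny-fuel _∙_ ∙-zeroʳ zero L' a b b≤0 _ rewrite n≤0⇒n≡0 b≤0 =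
  sym (anyBelow-false L' _ (λ i → trans (cong (bit i a ∙_) (bit-0 i)) (∙-zeroʳ _)))
bitwiseAny-fuel _∙_ ∙-zeroʳ (suc L) zero a b _ b≤0 rewrite n≤0⇒n≡0 b≤0 =
  anyBelow-false (suc L) _ (λ i → trans (cong (bit i a ∙_) (bit-0 i)) (∙-zeroʳ _))
bitwiseAny-fuel _∙_ ∙-zeroʳ (suc L) (suc L') a b b≤L b≤L' =
  cong ((bit 0 a ∙ bit 0 b) ∨_) (bitwiseAny-fuel _∙_ ∙-zeroʳ L L' (a / 2) (b / 2) (/2≤ b≤L) (/2≤ b≤L'))

bitwiseAny-digits : ∀ _∙_ → (∀ x → x ∙ false ≡ false) → ∀ {ca cb} a b → ca ≤ 1 → cb ≤ 1 →
  bitwiseAny _∙_ (suc (cb + 2 * b)) (ca + 2 * a) (cb + 2 * b) ≡ ((ca ≡ᵇ 1) ∙ (cb ≡ᵇ 1)) ∨ bitwiseAny _∙_ (suc b) a b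
bitwiseAny-digits _∙_ ∙-zeroʳ {ca} {cb} a b ca≤1 cb≤1 = cong₂ _∨_
  (cong₂ (λ u v → (u ≡ᵇ 1) ∙ (v ≡ᵇ 1)) ([c+2k]%2≡c ca a ca≤1) ([c+2k]%2≡c cb b cb≤1))
  (trans (cong₂ (bitwiseAny _∙_ (cb + 2 * b)) ([c+2k]/2≡k ca a ca≤1) ([c+2k]/2≡k cb b cb≤1))
         (bitwiseAny-fuel _∙_ ∙-zeroʳ (cb + 2 * b) (suc b) a b b≤cb+2b (n≤1+n b)))
  where
  b≤cb+2b : b ≤ cb + 2 * b
  b≤cb+2b = ≤-trans (m≤m+n b (b + 0)) (m≤n+m (2 * b) cb)

bitsOverlap : ℕ → ℕ → Bool
bitsOverlap h n = clash (ℤ.+ h) n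

bitsOverlap-bitwiseAny : ∀ h n → bitsOverlap h n ≡ bitwiseAny _∧_ (suc n) h n
bitsOverlap-bitwiseAny h n = any-applyUpTo (suc n) _ (λ i → i)

bitsOverlap-digits : ∀ {ch cn} h n → ch ≤ 1 → cn ≤ 1 →
  bitsOverlap (ch + 2 * h) (cn + 2 * n) ≡ ((ch ≡ᵇ 1) ∧ (cn ≡ᵇ 1)) ∨ bitsOverlap h n
bitsOverlap-digits {ch} {cn} h n ch≤1 cn≤1 = begin
  bitsOverlap (ch + 2 * h) (cn + 2 * n)                 ≡⟨ bitsOverlap-bitwiseAny (ch + 2 * h) (cn + 2 * n) ⟩
  bitwiseAny _∧_ (suc (cn + 2 * n)) (ch + 2 * h) (cn + 2 * n) ≡⟨ bitwiseAny-digits _∧_ ∧-zeroʳ h n ch≤1 cn≤1 ⟩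
  ((ch ≡ᵇ 1) ∧ (cn ≡ᵇ 1)) ∨ bitwiseAny _∧_ (suc n) h n  ≡⟨ cong (((ch ≡ᵇ 1) ∧ (cn ≡ᵇ 1)) ∨_) (bitsOverlap-bitwiseAny h n) ⟨
  ((ch ≡ᵇ 1) ∧ (cn ≡ᵇ 1)) ∨ bitsOverlap h n             ∎
  where open ≡-Reasoning

bitsOverlap-0 : ∀ n → bitsOverlap 0 n ≡ false
bitsOverlap-0 n = trans (bitsOverlap-bitwiseAny 0 n) (anyBelow-false (suc n) _ (λ i → cong (_∧ bit i n) (bit-0 i)))

popF-0 : ∀ L → popF L 0 ≡ 0
popF-0 zero    = refl
popF-0 (suc L) = popF-0 L

popF-fuel : ∀ L L' a → a ≤ L → a ≤ L' → popF L a ≡ popF L' a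
popF-fuel zero    L'       a a≤0 _   rewrite n≤0⇒n≡0 a≤0 = sym (popF-0 L')
popF-fuel (suc L) zero     a _   a≤0 rewrite n≤0⇒n≡0 a≤0 = popF-0 (suc L)
popF-fuel (suc L) (suc L') a a≤L a≤L' = cong (a % 2 +_) (popF-fuel L L' (a / 2) (/2≤ a≤L) (/2≤ a≤L'))

g-unfold : ∀ a → g a ≡ a % 2 + g (a / 2)
g-unfold zero    = refl
g-unfold (suc a) = cong (suc a % 2 +_) (popF-fuel a (suc a / 2) (suc a / 2) (/2≤ ≤-refl) ≤-refl)

g-digits : ∀ {c} k → c ≤ 1 → g (c + 2 * k) ≡ c + g k
g-digits {c} k c≤1 = trans (g-unfold (c + 2 * k)) (cong₂ (λ a b → a + g b) ([c+2k]%2≡c c k c≤1) ([c+2k]/2≡k c k c≤1))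

g-pos : ∀ n → 1 ≤ n → 1 ≤ g n
g-pos n = halving-ind₂ (λ n _ → 1 ≤ n → 1 ≤ g n) (λ ()) step n 0
  where
  step : ∀ a b → (1 ≤ a / 2 → 1 ≤ g (a / 2)) → 1 ≤ a → 1 ≤ g a
  step a _ ih 1≤a with parity a
  ... | odd k refl = subst (1 ≤_) (sym (g-digits k (s≤s z≤n))) (s≤s z≤n)
  ... | even zero refl = ⊥-elim (<⇒≱ 1≤a z≤n)
  ... | even (suc k) refl = subst (1 ≤_) (sym (g-unfold (2 * suc k))) (≤-trans (ih 1≤half) (m≤n+m _ _))
    where
    1≤half : 1 ≤ 2 * suc k / 2
    1≤half = subst (1 ≤_) (sym ([c+2k]/2≡k 0 (suc k) z≤n)) (s≤s z≤n)

∑ : ℕ → (ℕ → ℕ) → ℕ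
∑ zero    F = 0
∑ (suc n) F = ∑ n F + F n

∑-cong : ∀ n {F G : ℕ → ℕ} → (∀ i → i < n → F i ≡ G i) → ∑ n F ≡ ∑ n G
∑-cong zero    F≡G = refl
∑-cong (suc n) F≡G = cong₂ _+_ (∑-cong n (λ i i<n → F≡G i (m≤n⇒m≤1+n i<n))) (F≡G n ≤-refl)

∑-zero : ∀ n {F} → (∀ i → i < n → F i ≡ 0) → ∑ n F ≡ 0
∑-zero n F≡0 = trans (∑-cong n F≡0) (∑-const0 n)
  where
  ∑-const0 : ∀ n → ∑ n (λ _ → 0) ≡ 0
  ∑-const0 zero    = refl
  ∑-const0 (suc n) = cong (_+ 0) (∑-const0 n)

∑-head : ∀ n F → ∑ (suc n) F ≡ F 0 + ∑ n (λ i → F (suc i))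
∑-head zero    F = +-comm 0 (F 0)
∑-head (suc n) F = trans (cong (_+ F (suc n)) (∑-head n F)) (+-assoc (F 0) _ _)

∑-distrib-+ : ∀ n F G → ∑ n (λ i → F i + G i) ≡ ∑ n F + ∑ n G
∑-distrib-+ zero    F G = refl
∑-distrib-+ (suc n) F G = trans (cong (_+ (F n + G n)) (∑-distrib-+ n F G)) (+-+-swap (∑ n F) (∑ n G) (F n) (G n))
  where
  +-+-swap : ∀ a b c d → a + b + (c + d) ≡ a + c + (b + d)
  +-+-swap = solve-∀

∑-*ˡ : ∀ n c F → ∑ n (λ i → c * F i) ≡ c * ∑ n F
∑-*ˡ zero    c F = sym (*-zeroʳ c)
∑-*ˡ (suc n) c F = trans (cong (_+ c * F n) (∑-*ˡ n c F)) (sym (*-distribˡ-+ c (∑ n F) (F n)))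

∑-comm : ∀ m n (F : ℕ → ℕ → ℕ) → ∑ m (λ i → ∑ n (F i)) ≡ ∑ n (λ j → ∑ m (λ i → F i j))
∑-comm zero    n F = sym (∑-zero n (λ _ _ → refl))
∑-comm (suc m) n F = trans (cong (_+ ∑ n (F m)) (∑-comm m n F)) (sym (∑-distrib-+ n _ (F m)))

∑-+ : ∀ a k G → ∑ (a + k) G ≡ ∑ a G + ∑ k (λ i → G (a + i))
∑-+ a zero    G = trans (cong (λ t → ∑ t G) (+-identityʳ a)) (sym (+-identityʳ (∑ a G)))
∑-+ a (suc k) G rewrite +-suc a k | ∑-+ a k G = +-assoc (∑ a G) _ _

∑-vanishing-tail : ∀ m n F → m ≤ n → (∀ i → m ≤ i → i < n → F i ≡ 0) → ∑ n F ≡ ∑ m F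
∑-vanishing-tail m n F m≤n tail≡0 = begin
  ∑ n F                                       ≡⟨ cong (λ t → ∑ t F) (m+[n∸m]≡n m≤n) ⟨
  ∑ (m + (n ∸ m)) F                           ≡⟨ ∑-+ m (n ∸ m) F ⟩
  ∑ m F + ∑ (n ∸ m) (λ i → F (m + i))         ≡⟨ cong (∑ m F +_) (∑-zero (n ∸ m) inTail) ⟩
  ∑ m F + 0                                   ≡⟨ +-identityʳ _ ⟩
  ∑ m F                                       ∎
  where
  open ≡-Reasoning
  inTail : ∀ i → i < n ∸ m → F (m + i) ≡ 0
  inTail i i<n∸m = tail≡0 (m + i) (m≤m+n m i) (subst (m + i <_) (m+[n∸m]≡n m≤n) (+-monoʳ-< m i<n∸m))

∑-δ : ∀ n a G → a < n → (∀ i → i < n → i ≢ a → G i ≡ 0) → ∑ n G ≡ G a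
∑-δ n a G a<n G≡0 = begin
  ∑ n G          ≡⟨ ∑-vanishing-tail (suc a) n G a<n (λ i a<i i<n → G≡0 i i<n (λ i≡a → <⇒≢ a<i (sym i≡a))) ⟩
  ∑ a G + G a    ≡⟨ cong (_+ G a) (∑-zero a (λ i i<a → G≡0 i (<-trans i<a a<n) (<⇒≢ i<a))) ⟩
  G a            ∎
  where open ≡-Reasoning

∑-double : ∀ m F → ∑ (2 * m) F ≡ ∑ m (λ i → F (2 * i) + F (1 + 2 * i))
∑-double zero    F = refl
∑-double (suc m) F = begin
  ∑ (2 * suc m) F                                   ≡⟨ cong (λ t → ∑ t F) (*-suc 2 m) ⟩
  ∑ (2 * m) F + F (2 * m) + F (1 + 2 * m)           ≡⟨ +-assoc (∑ (2 * m) F) _ _ ⟩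
  ∑ (2 * m) F + (F (2 * m) + F (1 + 2 * m))         ≡⟨ cong (_+ (F (2 * m) + F (1 + 2 * m))) (∑-double m F) ⟩
  ∑ (suc m) (λ i → F (2 * i) + F (1 + 2 * i))       ∎
  where open ≡-Reasoning

∑² : ℕ → (ℕ → ℕ → ℕ) → ℕ
∑² M F = ∑ M (λ y → ∑ M (F y))

∑²-cong : ∀ M {F G : ℕ → ℕ → ℕ} → (∀ y z → F y z ≡ G y z) → ∑² M F ≡ ∑² M G
∑²-cong M F≡G = ∑-cong M (λ y _ → ∑-cong M (λ z _ → F≡G y z))

∑²-distrib-+ : ∀ M (F G : ℕ → ℕ → ℕ) → ∑² M (λ y z → F y z + G y z) ≡ ∑² M F + ∑² M G
∑²-distrib-+ M F G = trans (∑-cong M (λ y _ → ∑-distrib-+ M (F y) (G y))) (∑-distrib-+ M _ _)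

∑²-*ˡ : ∀ M c (F : ℕ → ℕ → ℕ) → ∑² M (λ y z → c * F y z) ≡ c * ∑² M F
∑²-*ˡ M c F = trans (∑-cong M (λ y _ → ∑-*ˡ M c (F y))) (∑-*ˡ M c _)

∑²-double : ∀ M (F : ℕ → ℕ → ℕ) → ∑² (2 * M) F ≡
  ∑² M (λ y z → (F (2 * y) (2 * z) + F (2 * y) (1 + 2 * z)) + (F (1 + 2 * y) (2 * z) + F (1 + 2 * y) (1 + 2 * z)))
∑²-double M F = begin
  ∑ (2 * M) (λ y → ∑ (2 * M) (F y))
    ≡⟨ ∑-double M _ ⟩
  ∑ M (λ y → ∑ (2 * M) (F (2 * y)) + ∑ (2 * M) (F (1 + 2 * y)))
    ≡⟨ ∑-cong M (λ y _ → cong₂ _+_ (∑-double M (F (2 * y))) (∑-double M (F (1 + 2 * y)))) ⟩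
  ∑ M (λ y → ∑ M (λ z → F (2 * y) (2 * z) + F (2 * y) (1 + 2 * z)) + ∑ M (λ z → F (1 + 2 * y) (2 * z) + F (1 + 2 * y) (1 + 2 * z)))
    ≡⟨ ∑-cong M (λ y _ → sym (∑-distrib-+ M _ _)) ⟩
  _ ∎
  where open ≡-Reasoning

∑³ : ℕ → (ℕ → ℕ → ℕ → ℕ) → ℕ
∑³ N F = ∑ N (λ i → ∑² N (F i))

∑³-cong : ∀ N {F G : ℕ → ℕ → ℕ → ℕ} → (∀ i j k → F i j k ≡ G i j k) → ∑³ N F ≡ ∑³ N G
∑³-cong N F≡G = ∑-cong N (λ i _ → ∑²-cong N (F≡G i))

∑³-distrib-+ : ∀ N (F G : ℕ → ℕ → ℕ → ℕ) → ∑³ N (λ i j k → F i j k + G i j k) ≡ ∑³ N F + ∑³ N G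
∑³-distrib-+ N F G = trans (∑-cong N (λ i _ → ∑²-distrib-+ N (F i) (G i))) (∑-distrib-+ N _ _)

∑³-swap₁₂ : ∀ N (F : ℕ → ℕ → ℕ → ℕ) → ∑³ N (λ i j k → F j i k) ≡ ∑³ N F
∑³-swap₁₂ N F = ∑-comm N N (λ i j → ∑ N (F j i))

∑³-rotate : ∀ N (F : ℕ → ℕ → ℕ → ℕ) → ∑³ N (λ i j k → F j k i) ≡ ∑³ N F
∑³-rotate N F = trans (∑-comm N N (λ i j → ∑ N (λ k → F j k i))) (∑-cong N (λ j _ → ∑-comm N N (λ i k → F j k i)))

sum-map-applyUpTo : ∀ n (F : ℕ → ℕ) (σ : ℕ → ℕ) → sum (map F (applyUpTo σ n)) ≡ ∑ n (λ i → F (σ i))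
sum-map-applyUpTo zero    F σ = refl
sum-map-applyUpTo (suc n) F σ = trans (cong (F (σ 0) +_) (sum-map-applyUpTo n F (λ i → σ (suc i)))) (sym (∑-head n _))

sum-map-range : ∀ a n (F : ℕ → ℕ) → sum (map F (range a n)) ≡ ∑ n (λ i → F (i + a))
sum-map-range a n F = trans (cong sum (sym (map-∘ (upTo n)))) (sum-map-applyUpTo n _ (λ i → i))

sum-map-range1 : ∀ n (F : ℕ → ℕ) → sum (map F (range 1 n)) ≡ ∑ n (λ i → F (suc i))
sum-map-range1 n F = trans (sum-map-range 1 n F) (∑-cong n (λ i _ → cong F (+-comm i 1)))

length-filterᵇ : ∀ {A : Set} (P : A → Bool) xs → length (filterᵇ P xs) ≡ sum (map (λ x → 𝟙 (P x)) xs)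
length-filterᵇ P []       = refl
length-filterᵇ P (x ∷ xs) with P x
... | true  = cong suc (length-filterᵇ P xs)
... | false = length-filterᵇ P xs

sum-map-concatMap : ∀ {A B : Set} (h : B → ℕ) (F : A → List B) xs →
  sum (map h (concatMap F xs)) ≡ sum (map (λ x → sum (map h (F x))) xs)
sum-map-concatMap h F []       = refl
sum-map-concatMap h F (x ∷ xs) = begin
  sum (map h (F x ++ concatMap F xs))                ≡⟨ cong sum (map-++ h (F x) _) ⟩
  sum (map h (F x) ++ map h (concatMap F xs))        ≡⟨ sum-++ (map h (F x)) _ ⟩
  sum (map h (F x)) + sum (map h (concatMap F xs))   ≡⟨ cong (sum (map h (F x)) +_) (sum-map-concatMap h F xs) ⟩
  sum (map h (F x)) + sum (map (λ x → sum (map h (F x))) xs) ∎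
  where open ≡-Reasoning

-- Pairs with prescribed sum and xor

sumXor : ℕ → ℕ → ℕ → ℕ → Bool
sumXor s n y z = (y + z ≡ᵇ s) ∧ (y ⊕ z ≡ᵇ n)

carrySumXor : ℕ → ℕ → ℕ → ℕ → Bool
carrySumXor s n y z = (suc (y + z) ≡ᵇ s) ∧ (y ⊕ z ≡ᵇ n)

#sumXor : ℕ → ℕ → ℕ → ℕ
#sumXor M s n = ∑² M (λ y z → 𝟙 (sumXor s n y z))

#carrySumXor : ℕ → ℕ → ℕ → ℕ
#carrySumXor M s n = ∑² M (λ y z → 𝟙 (carrySumXor s n y z))

sumXor-digits : ∀ {e f cs cn} y z s n → e ≤ 1 → f ≤ 1 → e + f ≤ 1 → cs ≤ 1 → cn ≤ 1 →
  sumXor (cs + 2 * s) (cn + 2 * n) (e + 2 * y) (f + 2 * z) ≡ ((e + f ≡ᵇ cs) ∧ (bitXor e f ≡ᵇ cn)) ∧ sumXor s n y z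
sumXor-digits {e} {f} {cs} {cn} y z s n e≤1 f≤1 e+f≤1 cs≤1 cn≤1 = begin
  sumXor (cs + 2 * s) (cn + 2 * n) (e + 2 * y) (f + 2 * z)
    ≡⟨ cong₂ (λ a b → (a ≡ᵇ cs + 2 * s) ∧ (b ≡ᵇ cn + 2 * n)) (+-digits e f y z) (⊕-digits y z e≤1 f≤1) ⟩
  ((e + f) + 2 * (y + z) ≡ᵇ cs + 2 * s) ∧ (bitXor e f + 2 * (y ⊕ z) ≡ᵇ cn + 2 * n)
    ≡⟨ cong₂ _∧_ (≡ᵇ-digits (y + z) s e+f≤1 cs≤1) (≡ᵇ-digits (y ⊕ z) n (bitXor≤1 e f) cn≤1) ⟩
  ((e + f ≡ᵇ cs) ∧ (y + z ≡ᵇ s)) ∧ ((bitXor e f ≡ᵇ cn) ∧ (y ⊕ z ≡ᵇ n))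
    ≡⟨ ∧-interchange (e + f ≡ᵇ cs) (y + z ≡ᵇ s) (bitXor e f ≡ᵇ cn) (y ⊕ z ≡ᵇ n) ⟩
  ((e + f ≡ᵇ cs) ∧ (bitXor e f ≡ᵇ cn)) ∧ sumXor s n y z ∎
  where
  open ≡-Reasoning
  +-digits : ∀ e f y z → (e + 2 * y) + (f + 2 * z) ≡ (e + f) + 2 * (y + z)
  +-digits = solve-∀

sumXor-carry : ∀ {cs cn} y z s n → cs ≤ 1 → cn ≤ 1 →
  sumXor (cs + 2 * s) (cn + 2 * n) (1 + 2 * y) (1 + 2 * z) ≡ ((0 ≡ᵇ cs) ∧ (0 ≡ᵇ cn)) ∧ carrySumXor s n y z
sumXor-carry {cs} {cn} y z s n cs≤1 cn≤1 = begin
  sumXor (cs + 2 * s) (cn + 2 * n) (1 + 2 * y) (1 + 2 * z)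
    ≡⟨ cong₂ (λ a b → (a ≡ᵇ cs + 2 * s) ∧ (b ≡ᵇ cn + 2 * n)) (+-carry y z) (⊕-digits y z (s≤s z≤n) (s≤s z≤n)) ⟩
  (0 + 2 * suc (y + z) ≡ᵇ cs + 2 * s) ∧ (0 + 2 * (y ⊕ z) ≡ᵇ cn + 2 * n)
    ≡⟨ cong₂ _∧_ (≡ᵇ-digits (suc (y + z)) s z≤n cs≤1) (≡ᵇ-digits (y ⊕ z) n z≤n cn≤1) ⟩
  ((0 ≡ᵇ cs) ∧ (suc (y + z) ≡ᵇ s)) ∧ ((0 ≡ᵇ cn) ∧ (y ⊕ z ≡ᵇ n))
    ≡⟨ ∧-interchange (0 ≡ᵇ cs) (suc (y + z) ≡ᵇ s) (0 ≡ᵇ cn) (y ⊕ z ≡ᵇ n) ⟩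
  ((0 ≡ᵇ cs) ∧ (0 ≡ᵇ cn)) ∧ carrySumXor s n y z ∎
  where
  open ≡-Reasoning
  +-carry : ∀ y z → (1 + 2 * y) + (1 + 2 * z) ≡ 0 + 2 * suc (y + z)
  +-carry = solve-∀

#sumXor-halve : ∀ M {cs cn} s n → cs ≤ 1 → cn ≤ 1 →
  #sumXor (2 * M) (cs + 2 * s) (cn + 2 * n) ≡
    𝟙 ((0 ≡ᵇ cs) ∧ (0 ≡ᵇ cn)) * (#sumXor M s n + #carrySumXor M s n)
      + 𝟙 ((1 ≡ᵇ cs) ∧ (1 ≡ᵇ cn)) * (#sumXor M s n + #sumXor M s n)
#sumXor-halve M {cs} {cn} s n cs≤1 cn≤1 = begin
  #sumXor (2 * M) (cs + 2 * s) (cn + 2 * n)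
    ≡⟨ ∑²-double M _ ⟩
  _ ≡⟨ ∑²-cong M lowDigits ⟩
  ∑² M (λ y z → c₀ * (G y z + H y z) + c₁ * (G y z + G y z))
    ≡⟨ ∑²-distrib-+ M _ _ ⟩
  ∑² M (λ y z → c₀ * (G y z + H y z)) + ∑² M (λ y z → c₁ * (G y z + G y z))
    ≡⟨ cong₂ _+_ (∑²-*ˡ M c₀ _) (∑²-*ˡ M c₁ _) ⟩
  c₀ * ∑² M (λ y z → G y z + H y z) + c₁ * ∑² M (λ y z → G y z + G y z)
    ≡⟨ cong₂ (λ a b → c₀ * a + c₁ * b) (∑²-distrib-+ M G H) (∑²-distrib-+ M G G) ⟩
  c₀ * (#sumXor M s n + #carrySumXor M s n) + c₁ * (#sumXor M s n + #sumXor M s n) ∎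
  where
  open ≡-Reasoning
  even₀ odd₁ : Bool
  even₀ = (0 ≡ᵇ cs) ∧ (0 ≡ᵇ cn)
  odd₁ = (1 ≡ᵇ cs) ∧ (1 ≡ᵇ cn)
  c₀ c₁ : ℕ
  c₀ = 𝟙 even₀
  c₁ = 𝟙 odd₁
  G H : ℕ → ℕ → ℕ
  G y z = 𝟙 (sumXor s n y z)
  H y z = 𝟙 (carrySumXor s n y z)
  S : ℕ → ℕ → ℕ → ℕ → ℕ
  S e f y z = 𝟙 (sumXor (cs + 2 * s) (cn + 2 * n) (e + 2 * y) (f + 2 * z))
  regroup : ∀ a b g h → a * g + b * g + (b * g + a * h) ≡ a * (g + h) + b * (g + g)
  regroup = solve-∀
  lowDigits : ∀ y z → (S 0 0 y z + S 0 1 y z) + (S 1 0 y z + S 1 1 y z) ≡ c₀ * (G y z + H y z) + c₁ * (G y z + G y z)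
  lowDigits y z = begin
    (S 0 0 y z + S 0 1 y z) + (S 1 0 y z + S 1 1 y z)
      ≡⟨ cong₂ _+_ (cong₂ _+_ (split even₀ (sumXor-digits y z s n z≤n z≤n z≤n cs≤1 cn≤1))
                              (split odd₁ (sumXor-digits y z s n z≤n ≤-refl ≤-refl cs≤1 cn≤1)))
                   (cong₂ _+_ (split odd₁ (sumXor-digits y z s n ≤-refl z≤n ≤-refl cs≤1 cn≤1))
                              (split even₀ (sumXor-carry y z s n cs≤1 cn≤1))) ⟩
    c₀ * G y z + c₁ * G y z + (c₁ * G y z + c₀ * H y z)
      ≡⟨ regroup c₀ c₁ (G y z) (H y z) ⟩
    c₀ * (G y z + H y z) + c₁ * (G y z + G y z) ∎
    where
    split : ∀ {a c} b → a ≡ b ∧ c → 𝟙 a ≡ 𝟙 b * 𝟙 c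
    split {c = c} b refl = 𝟙-∧ b c

#sumXor-even-even : ∀ M s n → #sumXor (2 * M) (2 * s) (2 * n) ≡ #sumXor M s n + #carrySumXor M s n
#sumXor-even-even M s n = trans (#sumXor-halve M s n z≤n z≤n) (trans (+-identityʳ _) (+-identityʳ _))

#sumXor-odd-odd : ∀ M s n → #sumXor (2 * M) (1 + 2 * s) (1 + 2 * n) ≡ #sumXor M s n + #sumXor M s n
#sumXor-odd-odd M s n = trans (#sumXor-halve M s n ≤-refl ≤-refl) (+-identityʳ _)

#sumXor-odd-even : ∀ M s n → #sumXor (2 * M) (1 + 2 * s) (2 * n) ≡ 0
#sumXor-odd-even M s n = #sumXor-halve M s n ≤-refl z≤n

#sumXor-even-odd : ∀ M s n → #sumXor (2 * M) (2 * s) (1 + 2 * n) ≡ 0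
#sumXor-even-odd M s n = #sumXor-halve M s n z≤n ≤-refl

#carrySumXor-0 : ∀ M n → #carrySumXor M 0 n ≡ 0
#carrySumXor-0 M n = ∑-zero M (λ _ _ → ∑-zero M (λ _ _ → refl))

#sumXor-unreachable : ∀ L s n → (∀ h → s ≢ n + 2 * h) → #sumXor (2 ^ L) s n ≡ 0
#sumXor-unreachable zero zero    zero    s≢n+2h = ⊥-elim (s≢n+2h 0 refl)
#sumXor-unreachable zero zero    (suc n) s≢n+2h = refl
#sumXor-unreachable zero (suc s) n       s≢n+2h = refl
#sumXor-unreachable (suc L) s n s≢n+2h with parity s | parity n
... | even s refl | even n refl = begin
  #sumXor (2 * 2 ^ L) (2 * s) (2 * n)                   ≡⟨ #sumXor-even-even (2 ^ L) s n ⟩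
  #sumXor (2 ^ L) s n + #carrySumXor (2 ^ L) s n        ≡⟨ cong₂ _+_ (#sumXor-unreachable L s n (λ h eq → s≢n+2h (2 * h) (2*-shift {h} eq))) (carry s refl) ⟩
  0                                                     ∎
  where
  open ≡-Reasoning
  2*-shift : ∀ {h} → s ≡ n + 2 * h → 2 * s ≡ 2 * n + 2 * (2 * h)
  2*-shift {h} eq = trans (cong (2 *_) eq) (*-distribˡ-+ 2 n (2 * h))
  carry : ∀ t → t ≡ s → #carrySumXor (2 ^ L) t n ≡ 0
  carry zero    _    = #carrySumXor-0 (2 ^ L) n
  carry (suc t) t≡s  = #sumXor-unreachable L t n (λ h eq → s≢n+2h (1 + 2 * h) (trans (cong (2 *_) (trans (sym t≡s) (cong suc eq))) (odd-shift n h)))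
    where
    odd-shift : ∀ n h → 2 * suc (n + 2 * h) ≡ 2 * n + 2 * (1 + 2 * h)
    odd-shift = solve-∀
... | even s refl | odd n refl = #sumXor-even-odd (2 ^ L) s n
... | odd s refl  | even n refl = #sumXor-odd-even (2 ^ L) s n
... | odd s refl  | odd n refl = begin
  #sumXor (2 * 2 ^ L) (1 + 2 * s) (1 + 2 * n)      ≡⟨ #sumXor-odd-odd (2 ^ L) s n ⟩
  #sumXor (2 ^ L) s n + #sumXor (2 ^ L) s n        ≡⟨ cong (λ x → x + x) (#sumXor-unreachable L s n (λ h eq → s≢n+2h (2 * h) (1+2*-shift {h} eq))) ⟩
  0                                                ∎
  where
  open ≡-Reasoning
  1+2*-shift : ∀ {h} → s ≡ n + 2 * h → 1 + 2 * s ≡ (1 + 2 * n) + 2 * (2 * h)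
  1+2*-shift {h} eq = trans (cong (λ x → 1 + 2 * x) eq) (shift n h)
    where
    shift : ∀ n h → 1 + 2 * (n + 2 * h) ≡ (1 + 2 * n) + 2 * (2 * h)
    shift = solve-∀

splitCount : ℕ → ℕ → ℕ
splitCount h n = 𝟙 (not (bitsOverlap h n)) * 2 ^ g n

splitCount-even-even : ∀ h n → splitCount (2 * h) (2 * n) ≡ splitCount h n
splitCount-even-even h n = cong₂ (λ b k → 𝟙 (not b) * 2 ^ k) (bitsOverlap-digits {0} {0} h n z≤n z≤n) (g-digits {0} n z≤n)

splitCount-even-odd : ∀ h n → splitCount (2 * h) (1 + 2 * n) ≡ splitCount h n + splitCount h n
splitCount-even-odd h n = begin
  splitCount (2 * h) (1 + 2 * n) ≡⟨ cong₂ (λ b k → 𝟙 (not b) * 2 ^ k) (bitsOverlap-digits {0} {1} h n z≤n ≤-refl) (g-digits {1} n ≤-refl) ⟩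
  c * (2 * 2 ^ g n)              ≡⟨ double c (2 ^ g n) ⟨
  splitCount h n + splitCount h n ∎
  where
  open ≡-Reasoning
  c : ℕ
  c = 𝟙 (not (bitsOverlap h n))
  double : ∀ c p → c * p + c * p ≡ c * (2 * p)
  double = solve-∀

splitCount-odd-odd : ∀ h n → splitCount (1 + 2 * h) (1 + 2 * n) ≡ 0
splitCount-odd-odd h n = cong (λ b → 𝟙 (not b) * 2 ^ g (1 + 2 * n)) (bitsOverlap-digits {1} {1} h n ≤-refl ≤-refl)

splitCount-odd-even : ∀ h n → splitCount (1 + 2 * h) (2 * n) ≡ splitCount h n
splitCount-odd-even h n = cong₂ (λ b k → 𝟙 (not b) * 2 ^ k) (bitsOverlap-digits {1} {0} h n ≤-refl z≤n) (g-digits {0} n z≤n)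

#sumXor-reachable : ∀ L n h → n + 2 * h < 2 ^ L → #sumXor (2 ^ L) (n + 2 * h) n ≡ splitCount h n
#sumXor-reachable zero zero    zero    _            = refl
#sumXor-reachable zero (suc n) h       (s≤s ())
#sumXor-reachable zero zero    (suc h) (s≤s ())
#sumXor-reachable (suc L) n h n+2h<2M with parity n | parity h
... | even n refl | even h refl = begin
  #sumXor (2 * 2 ^ L) (2 * n + 2 * (2 * h)) (2 * n)               ≡⟨ cong (λ x → #sumXor (2 * 2 ^ L) x (2 * n)) regroup ⟩
  #sumXor (2 * 2 ^ L) (2 * (n + 2 * h)) (2 * n)                   ≡⟨ #sumXor-even-even (2 ^ L) (n + 2 * h) n ⟩
  #sumXor (2 ^ L) (n + 2 * h) n + #carrySumXor (2 ^ L) (n + 2 * h) n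
    ≡⟨ cong₂ _+_ (#sumXor-reachable L n h (halve-bound 0 (subst (_< 2 * 2 ^ L) regroup n+2h<2M))) (noCarry (n + 2 * h) refl) ⟩
  splitCount h n + 0                                              ≡⟨ trans (+-identityʳ _) (sym (splitCount-even-even h n)) ⟩
  splitCount (2 * h) (2 * n)                                      ∎
  where
  open ≡-Reasoning
  regroup : 2 * n + 2 * (2 * h) ≡ 2 * (n + 2 * h)
  regroup = sym (*-distribˡ-+ 2 n (2 * h))
  noCarry : ∀ t → t ≡ n + 2 * h → #carrySumXor (2 ^ L) t n ≡ 0
  noCarry zero    _   = #carrySumXor-0 (2 ^ L) n
  noCarry (suc t) t≡s = #sumXor-unreachable L t n
    (λ k eq → 1+2a≢2b k h (+-cancelˡ-≡ n _ _ (trans (+-suc n (2 * k)) (trans (cong suc (sym eq)) t≡s))))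
... | odd n refl | even h refl = begin
  #sumXor (2 * 2 ^ L) ((1 + 2 * n) + 2 * (2 * h)) (1 + 2 * n)     ≡⟨ cong (λ x → #sumXor (2 * 2 ^ L) x (1 + 2 * n)) (regroup n h) ⟩
  #sumXor (2 * 2 ^ L) (1 + 2 * (n + 2 * h)) (1 + 2 * n)           ≡⟨ #sumXor-odd-odd (2 ^ L) (n + 2 * h) n ⟩
  #sumXor (2 ^ L) (n + 2 * h) n + #sumXor (2 ^ L) (n + 2 * h) n
    ≡⟨ cong (λ x → x + x) (#sumXor-reachable L n h (halve-bound 1 (subst (_< 2 * 2 ^ L) (regroup n h) n+2h<2M))) ⟩
  splitCount h n + splitCount h n                                 ≡⟨ splitCount-even-odd h n ⟨
  splitCount (2 * h) (1 + 2 * n)                                  ∎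
  where
  open ≡-Reasoning
  regroup : ∀ n h → (1 + 2 * n) + 2 * (2 * h) ≡ 1 + 2 * (n + 2 * h)
  regroup = solve-∀
... | odd n refl | odd h refl = begin
  #sumXor (2 * 2 ^ L) ((1 + 2 * n) + 2 * (1 + 2 * h)) (1 + 2 * n) ≡⟨ cong (λ x → #sumXor (2 * 2 ^ L) x (1 + 2 * n)) (regroup n h) ⟩
  #sumXor (2 * 2 ^ L) (1 + 2 * (n + suc (2 * h))) (1 + 2 * n)     ≡⟨ #sumXor-odd-odd (2 ^ L) (n + suc (2 * h)) n ⟩
  #sumXor (2 ^ L) (n + suc (2 * h)) n + #sumXor (2 ^ L) (n + suc (2 * h)) n
    ≡⟨ cong (λ x → x + x) (#sumXor-unreachable L _ n (λ k eq → 1+2a≢2b h k (+-cancelˡ-≡ n _ _ eq))) ⟩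
  0                                                               ≡⟨ splitCount-odd-odd h n ⟨
  splitCount (1 + 2 * h) (1 + 2 * n)                              ∎
  where
  open ≡-Reasoning
  regroup : ∀ n h → (1 + 2 * n) + 2 * (1 + 2 * h) ≡ 1 + 2 * (n + suc (2 * h))
  regroup = solve-∀
... | even n refl | odd h refl = begin
  #sumXor (2 * 2 ^ L) (2 * n + 2 * (1 + 2 * h)) (2 * n)           ≡⟨ cong (λ x → #sumXor (2 * 2 ^ L) x (2 * n)) (regroup n h) ⟩
  #sumXor (2 * 2 ^ L) (2 * suc (n + 2 * h)) (2 * n)               ≡⟨ #sumXor-even-even (2 ^ L) (suc (n + 2 * h)) n ⟩
  #sumXor (2 ^ L) (suc (n + 2 * h)) n + #sumXor (2 ^ L) (n + 2 * h) n
    ≡⟨ cong₂ _+_ (#sumXor-unreachable L _ n (λ k eq → 1+2a≢2b h k (+-cancelˡ-≡ n _ _ (trans (+-suc n (2 * h)) eq))))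
                 (#sumXor-reachable L n h (<-trans (n<1+n _) (halve-bound 0 (subst (_< 2 * 2 ^ L) (regroup n h) n+2h<2M)))) ⟩
  splitCount h n                                                  ≡⟨ splitCount-odd-even h n ⟨
  splitCount (1 + 2 * h) (2 * n)                                  ∎
  where
  open ≡-Reasoning
  regroup : ∀ n h → 2 * n + 2 * (1 + 2 * h) ≡ 2 * suc (n + 2 * h)
  regroup = solve-∀

-- The function f

fᵈ : ℤ.ℤ → ℤ.ℤ → ℕ → ℕ
fᵈ s d x = if oddℤ d then 0 else if clash (halfℤ d) x then 0 else if does (s ℤ.≟ ℤ.+ x) then 2 ^ (g x ∸ 1) ∸ 1 else 2 ^ (g x ∸ 1)

f-by-difference : ∀ s x → f s x ≡ fᵈ s (s ℤ.- ℤ.+ x) x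
f-by-difference s x with oddℤ (s ℤ.- ℤ.+ x)
... | true = refl
... | false with clash (halfℤ (s ℤ.- ℤ.+ x)) x
...   | true = refl
...   | false with s ℤ.≟ ℤ.+ x
...     | yes _ = refl
...     | no  _ = refl

[+m]-[+n]≡+[m∸n] : ∀ {m n} → n ≤ m → ℤ.+ m ℤ.- ℤ.+ n ≡ ℤ.+ (m ∸ n)
[+m]-[+n]≡+[m∸n] {m} {n} n≤m = trans (ℤP.[+m]-[+n]≡m⊖n m n) (ℤP.⊖-≥ n≤m)

f-at-even-distance : ∀ n h →
  f (ℤ.+ (n + 2 * h)) n ≡ (if bitsOverlap h n then 0 else if n + 2 * h ≡ᵇ n then 2 ^ (g n ∸ 1) ∸ 1 else 2 ^ (g n ∸ 1))
f-at-even-distance n h = begin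
  f (ℤ.+ (n + 2 * h)) n                         ≡⟨ f-by-difference (ℤ.+ (n + 2 * h)) n ⟩
  fᵈ (ℤ.+ (n + 2 * h)) (ℤ.+ (n + 2 * h) ℤ.- ℤ.+ n) n ≡⟨ cong (λ d → fᵈ (ℤ.+ (n + 2 * h)) d n) difference ⟩
  fᵈ (ℤ.+ (n + 2 * h)) (ℤ.+ (0 + 2 * h)) n      ≡⟨ cong₂ (λ o c → if o then 0 else if clash c n then 0 else R) evenDistance (cong ℤ.+_ ([c+2k]/2≡k 0 h z≤n)) ⟩
  _                                             ∎
  where
  open ≡-Reasoning
  difference : ℤ.+ (n + 2 * h) ℤ.- ℤ.+ n ≡ ℤ.+ (0 + 2 * h)
  difference = trans ([+m]-[+n]≡+[m∸n] (m≤m+n n _)) (cong ℤ.+_ (m+n∸m≡n n _))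
  R : ℕ
  R = if n + 2 * h ≡ᵇ n then 2 ^ (g n ∸ 1) ∸ 1 else 2 ^ (g n ∸ 1)
  evenDistance : oddℤ (ℤ.+ (2 * h)) ≡ false
  evenDistance = cong (_≡ᵇ 1) ([c+2k]%2≡c 0 h z≤n)

2*2^[g∸1]≡2^g : ∀ n → 1 ≤ n → 2 * 2 ^ (g n ∸ 1) ≡ 2 ^ g n
2*2^[g∸1]≡2^g n 1≤n with g n | g-pos n 1≤n
... | suc k | _ = refl

f-reachable : ∀ n h → 1 ≤ n → 2 * (𝟙 (n + 2 * h ≡ᵇ n) + f (ℤ.+ (n + 2 * h)) n) ≡ splitCount h n
f-reachable n h 1≤n rewrite f-at-even-distance n h = byCases h (bitsOverlap h n) refl
  where
  byCases : ∀ h o → bitsOverlap h n ≡ o →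
    2 * (𝟙 (n + 2 * h ≡ᵇ n) + (if o then 0 else if n + 2 * h ≡ᵇ n then 2 ^ (g n ∸ 1) ∸ 1 else 2 ^ (g n ∸ 1))) ≡ 𝟙 (not o) * 2 ^ g n
  byCases zero    true  overlaps = ⊥-elim (subst T (trans (sym overlaps) (bitsOverlap-0 n)) _)
  byCases zero    false _ rewrite +-identityʳ n | ≡ᵇ-refl n = begin
    2 * (1 + (2 ^ (g n ∸ 1) ∸ 1))  ≡⟨ cong (2 *_) (m+[n∸m]≡n (m^n>0 2 (g n ∸ 1))) ⟩
    2 * 2 ^ (g n ∸ 1)              ≡⟨ 2*2^[g∸1]≡2^g n 1≤n ⟩
    2 ^ g n                        ≡⟨ +-identityʳ _ ⟨
    1 * 2 ^ g n                    ∎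
    where open ≡-Reasoning
  byCases (suc h) true  _ rewrite n+1+k≢ᵇn n (h + suc (h + 0)) = refl
  byCases (suc h) false _ rewrite n+1+k≢ᵇn n (h + suc (h + 0)) = trans (2*2^[g∸1]≡2^g n 1≤n) (sym (+-identityʳ _))

%2-mono : ∀ k n → (not (bit 0 k) ∧ bit 0 n) ≡ false → n % 2 ≤ k % 2
%2-mono k n lowNotMissing with k % 2 | m%2≤1 k | n % 2 | m%2≤1 n
%2-mono k n _  | _ | _ | 0 | _ = z≤n
%2-mono k n _  | 1 | _ | 1 | _ = ≤-refl
%2-mono k n () | 0 | _ | 1 | _
%2-mono k n _  | suc (suc _) | s≤s () | _ | _
%2-mono k n _  | _ | _ | suc (suc _) | s≤s ()

≤-of-bitsSubset : ∀ L k n → n ≤ L → bitwiseAny (λ u v → not u ∧ v) L k n ≡ false → n ≤ k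
≤-of-bitsSubset zero    k n n≤0 _ rewrite n≤0⇒n≡0 n≤0 = z≤n
≤-of-bitsSubset (suc L) k n n≤L noneMissing
  with not (bit 0 k) ∧ bit 0 n in lowMissing | noneMissing
... | false | restMissing = subst₂ _≤_ (m%2+2*[m/2]≡m n) (m%2+2*[m/2]≡m k)
        (+-mono-≤ (%2-mono k n lowMissing) (*-monoʳ-≤ 2 (≤-of-bitsSubset L (k / 2) (n / 2) (/2≤ n≤L) restMissing)))

f-unreachable : ∀ s n → (∀ h → s ≢ n + 2 * h) → f (ℤ.+ s) n ≡ 0
f-unreachable s n s≢n+2h with n ≤? s
... | yes n≤s with parity (s ∸ n)
...   | even h s∸n≡2h = ⊥-elim (s≢n+2h h (trans (sym (m+[n∸m]≡n n≤s)) (cong (n +_) s∸n≡2h)))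
...   | odd h s∸n≡1+2h = trans (f-by-difference (ℤ.+ s) n) (trans (cong (λ d → fᵈ (ℤ.+ s) d n) difference) (if-then-0 difference-odd))
  where
  difference-odd : oddℤ (ℤ.+ (1 + 2 * h)) ≡ true
  difference-odd = cong (_≡ᵇ 1) ([c+2k]%2≡c 1 h (s≤s z≤n))
  difference : ℤ.+ s ℤ.- ℤ.+ n ≡ ℤ.+ (1 + 2 * h)
  difference = trans ([+m]-[+n]≡+[m∸n] n≤s) (cong ℤ.+_ s∸n≡1+2h)
f-unreachable s n s≢n+2h | no n≰s with n ∸ s in n∸s≡
... | zero  = ⊥-elim (n≰s (m∸n≡0⇒m≤n n∸s≡))
... | suc m = trans (f-by-difference (ℤ.+ s) n) (trans (cong (λ d → fᵈ (ℤ.+ s) d n) difference) clashes)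
  where
  difference : ℤ.+ s ℤ.- ℤ.+ n ≡ ℤ.-[1+ m ]
  difference = trans (ℤP.[+m]-[+n]≡m⊖n s n) (trans (ℤP.⊖-< (≰⇒> n≰s)) (cong (λ t → ℤ.- ℤ.+ t) n∸s≡))
  -- -[1+ m ] / 2 = -[1+ m / 2 ] has the bits of the complement of m / 2 < n, so it meets n.
  meets : clash (halfℤ ℤ.-[1+ m ]) n ≡ true
  meets with clash (halfℤ ℤ.-[1+ m ]) n in noClash
  ... | true  = refl
  ... | false = ⊥-elim (<⇒≱ m/2<n (≤-of-bitsSubset (suc n) (m / 2) n (n≤1+n n) (trans (sym (any-applyUpTo (suc n) _ (λ i → i))) noClash)))
    where
    m/2<n : m / 2 < n
    m/2<n = ≤-<-trans (m/n≤m m 2) (≤-trans (≤-reflexive (sym n∸s≡)) (m∸n≤m n s))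
  clashes : fᵈ (ℤ.+ s) ℤ.-[1+ m ] n ≡ 0
  clashes with oddℤ ℤ.-[1+ m ]
  ... | true  = refl
  ... | false = if-then-0 meets

-- Pairs 0 < y < z

sumXor-sym : ∀ s n y z → sumXor s n z y ≡ sumXor s n y z
sumXor-sym s n y z = cong₂ (λ a b → (a ≡ᵇ s) ∧ (b ≡ᵇ n)) (+-comm z y) (⊕-comm z y)

-- A nonzero xor rules out y = z.
sumXor-split : ∀ s n y z → 1 ≤ n →
  𝟙 (sumXor s n y z) ≡ 𝟙 ((y <ᵇ z) ∧ sumXor s n y z) + 𝟙 ((z <ᵇ y) ∧ sumXor s n y z)
sumXor-split s n y z 1≤n with <-cmp y z
... | tri< y<z _ _ rewrite <ᵇ-true y<z | <ᵇ-false (<⇒≤ y<z) = sym (+-identityʳ _)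
... | tri> _ _ z<y rewrite <ᵇ-true z<y | <ᵇ-false (<⇒≤ z<y) = refl
... | tri≈ _ refl _ rewrite <ᵇ-false (≤-refl {y}) | ⊕-self y | ≡ᵇ-false (<⇒≢ 1≤n) = cong 𝟙 (∧-zeroʳ (y + y ≡ᵇ s))

#increasingSumXor : ℕ → ℕ → ℕ → ℕ
#increasingSumXor M s n = ∑² M (λ y z → 𝟙 ((y <ᵇ z) ∧ sumXor s n y z))

#positiveIncreasingSumXor : ℕ → ℕ → ℕ → ℕ
#positiveIncreasingSumXor N s n = ∑² N (λ j k → 𝟙 ((suc j <ᵇ suc k) ∧ sumXor s n (suc j) (suc k)))

#sumXor-increasing : ∀ M s n → 1 ≤ n → #sumXor M s n ≡ #increasingSumXor M s n + #increasingSumXor M s n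
#sumXor-increasing M s n 1≤n = begin
  #sumXor M s n
    ≡⟨ ∑²-cong M (λ y z → sumXor-split s n y z 1≤n) ⟩
  ∑² M (λ y z → 𝟙 ((y <ᵇ z) ∧ sumXor s n y z) + 𝟙 ((z <ᵇ y) ∧ sumXor s n y z))
    ≡⟨ ∑²-distrib-+ M _ _ ⟩
  #increasingSumXor M s n + ∑² M (λ y z → 𝟙 ((z <ᵇ y) ∧ sumXor s n y z))
    ≡⟨ cong (#increasingSumXor M s n +_) (trans (∑-comm M M _) (∑²-cong M (λ y z → cong (λ b → 𝟙 ((y <ᵇ z) ∧ b)) (sumXor-sym s n y z)))) ⟩
  #increasingSumXor M s n + #increasingSumXor M s n ∎
  where open ≡-Reasoning

#increasingSumXor-positive : ∀ N s n → 1 ≤ n → s ≤ N →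
  #increasingSumXor (suc N) s n ≡ 𝟙 (s ≡ᵇ n) + #positiveIncreasingSumXor N s n
#increasingSumXor-positive N s n 1≤n s≤N = begin
  #increasingSumXor (suc N) s n
    ≡⟨ ∑-head N _ ⟩
  ∑ (suc N) (λ z → 𝟙 ((0 <ᵇ z) ∧ sumXor s n 0 z)) + ∑ N (λ j → ∑ (suc N) (λ z → 𝟙 ((suc j <ᵇ z) ∧ sumXor s n (suc j) z)))
    ≡⟨ cong₂ _+_ fromZero (∑-cong N (λ j _ → ∑-head N _)) ⟩
  𝟙 (s ≡ᵇ n) + #positiveIncreasingSumXor N s n ∎
  where
  open ≡-Reasoning
  atS : ∀ s → 𝟙 ((0 <ᵇ s) ∧ sumXor s n 0 s) ≡ 𝟙 (s ≡ᵇ n)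
  atS zero    = cong 𝟙 (sym (≡ᵇ-false {0} {n} (<⇒≢ 1≤n)))
  atS (suc t) rewrite ≡ᵇ-refl t | ⊕-identityˡ (suc t) = refl
  fromZero : ∑ (suc N) (λ z → 𝟙 ((0 <ᵇ z) ∧ sumXor s n 0 z)) ≡ 𝟙 (s ≡ᵇ n)
  fromZero = trans (∑-δ (suc N) s _ (s≤s s≤N) offS) (atS s)
    where
    offS : ∀ z → z < suc N → z ≢ s → 𝟙 ((0 <ᵇ z) ∧ sumXor s n 0 z) ≡ 0
    offS z _ z≢s rewrite ≡ᵇ-false z≢s = cong 𝟙 (∧-zeroʳ (0 <ᵇ z))

#sumXor-beyond : ∀ M M' s n → s < M → M ≤ M' → #sumXor M' s n ≡ #sumXor M s n
#sumXor-beyond M M' s n s<M M≤M' = begin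
  ∑ M' (λ y → ∑ M' (G y))  ≡⟨ ∑-vanishing-tail M M' _ M≤M' (λ y M≤y _ → ∑-zero M' (λ z _ → tooBig y z (<-≤-trans s<M (≤-trans M≤y (m≤m+n y z))))) ⟩
  ∑ M (λ y → ∑ M' (G y))   ≡⟨ ∑-cong M (λ y _ → ∑-vanishing-tail M M' _ M≤M' (λ z M≤z _ → tooBig y z (<-≤-trans s<M (≤-trans M≤z (m≤n+m z y))))) ⟩
  ∑ M (λ y → ∑ M (G y))    ∎
  where
  open ≡-Reasoning
  G : ℕ → ℕ → ℕ
  G y z = 𝟙 (sumXor s n y z)
  tooBig : ∀ y z → s < y + z → G y z ≡ 0
  tooBig y z s<y+z rewrite ≡ᵇ-false {y + z} {s} (λ eq → <⇒≢ s<y+z (sym eq)) = refl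

reachability : ∀ s n → Σ ℕ (λ h → s ≡ n + 2 * h) ⊎ (∀ h → s ≢ n + 2 * h)
reachability s n with n ≤? s
... | no n≰s = inj₂ (λ h s≡n+2h → n≰s (subst (n ≤_) (sym s≡n+2h) (m≤m+n n _)))
... | yes n≤s with parity (s ∸ n)
...   | even h s∸n≡2h   = inj₁ (h , trans (sym (m+[n∸m]≡n n≤s)) (cong (n +_) s∸n≡2h))
...   | odd h s∸n≡1+2h = inj₂ (λ k s≡n+2k → 1+2a≢2b h k (trans (sym s∸n≡1+2h) (trans (cong (_∸ n) s≡n+2k) (m+n∸m≡n n _))))

#sumXor-as-increasing : ∀ N s n → 1 ≤ n → s ≤ N →
  #sumXor (2 ^ suc N) s n ≡ 2 * (𝟙 (s ≡ᵇ n) + #positiveIncreasingSumXor N s n)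
#sumXor-as-increasing N s n 1≤n s≤N = begin
  #sumXor (2 ^ suc N) s n
    ≡⟨ #sumXor-beyond (suc N) (2 ^ suc N) s n (s≤s s≤N) (<⇒≤ (n<2^n (suc N))) ⟩
  #sumXor (suc N) s n
    ≡⟨ #sumXor-increasing (suc N) s n 1≤n ⟩
  #increasingSumXor (suc N) s n + #increasingSumXor (suc N) s n
    ≡⟨ cong (λ u → u + u) (#increasingSumXor-positive N s n 1≤n s≤N) ⟩
  (𝟙 (s ≡ᵇ n) + P) + (𝟙 (s ≡ᵇ n) + P)
    ≡⟨ cong ((𝟙 (s ≡ᵇ n) + P) +_) (+-identityʳ _) ⟨
  2 * (𝟙 (s ≡ᵇ n) + P) ∎
  where
  open ≡-Reasoning
  P : ℕ
  P = #positiveIncreasingSumXor N s n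

#positiveIncreasingSumXor≡f : ∀ N s n → 1 ≤ n → s ≤ N → #positiveIncreasingSumXor N s n ≡ f (ℤ.+ s) n
#positiveIncreasingSumXor≡f N s n 1≤n s≤N with reachability s n
... | inj₂ unreachable = begin
  P             ≡⟨ m+n≡0⇒n≡0 (𝟙 (s ≡ᵇ n)) (*-cancelˡ-≡ _ 0 2 (trans (sym (#sumXor-as-increasing N s n 1≤n s≤N)) (#sumXor-unreachable (suc N) s n unreachable))) ⟩
  0             ≡⟨ f-unreachable s n unreachable ⟨
  f (ℤ.+ s) n   ∎
  where
  open ≡-Reasoning
  P : ℕ
  P = #positiveIncreasingSumXor N s n
... | inj₁ (h , refl) = +-cancelˡ-≡ (𝟙 (s ≡ᵇ n)) _ _ (*-cancelˡ-≡ _ _ 2 (begin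
  2 * (𝟙 (s ≡ᵇ n) + #positiveIncreasingSumXor N s n)  ≡⟨ #sumXor-as-increasing N s n 1≤n s≤N ⟨
  #sumXor (2 ^ suc N) s n                            ≡⟨ #sumXor-reachable (suc N) n h (<-trans (s≤s s≤N) (n<2^n (suc N))) ⟩
  splitCount h n                                     ≡⟨ f-reachable n h 1≤n ⟨
  2 * (𝟙 (s ≡ᵇ n) + f (ℤ.+ s) n)                     ∎))
  where open ≡-Reasoning

-- Zero-nim triples

zeroXor-rotate : ∀ x y z → ((y ⊕ z) ⊕ x ≡ᵇ 0) ≡ ((x ⊕ y) ⊕ z ≡ᵇ 0)
zeroXor-rotate x y z = T-ext
  (λ t → a⊕b≡c⇒[a⊕b]⊕c≡0 x y (⊕-rotate z x (⊕-rotate y z ([a⊕b]⊕c≡0⇒a⊕b≡c y z x t))))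
  (λ t → a⊕b≡c⇒[a⊕b]⊕c≡0 y z (⊕-rotate x y ([a⊕b]⊕c≡0⇒a⊕b≡c x y z t)))

zeroXor-as-pair : ∀ x y z → ((x ⊕ y) ⊕ z ≡ᵇ 0) ≡ (y ⊕ z ≡ᵇ x)
zeroXor-as-pair x y z = T-ext
  (λ t → ≡⇒≡ᵇ (y ⊕ z) x (⊕-rotate x y ([a⊕b]⊕c≡0⇒a⊕b≡c x y z t)))
  (λ t → a⊕b≡c⇒[a⊕b]⊕c≡0 x y (⊕-rotate z x (⊕-rotate y z (≡ᵇ⇒≡ (y ⊕ z) x t))))

zeroNim≤ : ℕ → ℕ → ℕ → ℕ → Bool
zeroNim≤ K x y z = (x + y + z ≤ᵇ K) ∧ ((x ⊕ y) ⊕ z ≡ᵇ 0)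

zeroNim≤-swap₁₂ : ∀ K x y z → zeroNim≤ K y x z ≡ zeroNim≤ K x y z
zeroNim≤-swap₁₂ K x y z = cong₂ (λ a b → (a + z ≤ᵇ K) ∧ (b ⊕ z ≡ᵇ 0)) (+-comm y x) (⊕-comm y x)

zeroNim≤-rotate : ∀ K x y z → zeroNim≤ K y z x ≡ zeroNim≤ K x y z
zeroNim≤-rotate K x y z = cong₂ _∧_ (cong (_≤ᵇ K) (rotate-+ x y z)) (zeroXor-rotate x y z)
  where
  rotate-+ : ∀ x y z → y + z + x ≡ x + y + z
  rotate-+ = solve-∀

zeroNim-distinct : ∀ {x y z} → 1 ≤ x → 1 ≤ y → 1 ≤ z → x ⊕ y ≡ z → x ≢ y × y ≢ z × x ≢ z
zeroNim-distinct {x} {y} {z} 1≤x 1≤y 1≤z x⊕y≡z =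
    (λ { refl → <⇒≢ 1≤z (sym (trans (sym x⊕y≡z) (⊕-self x))) })
  , (λ { refl → <⇒≢ 1≤x (sym (trans (sym (⊕-rotate x y x⊕y≡z)) (⊕-self y))) })
  , (λ { refl → <⇒≢ 1≤y (sym (trans (sym (⊕-rotate y x (⊕-rotate x y x⊕y≡z))) (⊕-self x))) })

𝟙-insert : ∀ x y z → x ≢ y → y ≢ z → x ≢ z →
  𝟙 (y <ᵇ z) ≡ 𝟙 ((x ≤ᵇ y) ∧ (y ≤ᵇ z)) + 𝟙 ((y ≤ᵇ x) ∧ (x ≤ᵇ z)) + 𝟙 ((y ≤ᵇ z) ∧ (z ≤ᵇ x))
𝟙-insert x y z x≢y y≢z x≢z with <-cmp y z | <-cmp x y | <-cmp x z
... | tri≈ _ y≡z _ | _ | _ = ⊥-elim (y≢z y≡z)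
... | _ | tri≈ _ x≡y _ | _ = ⊥-elim (x≢y x≡y)
... | _ | _ | tri≈ _ x≡z _ = ⊥-elim (x≢z x≡z)
... | tri< y<z _ _ | tri< x<y _ _ | _
  rewrite <ᵇ-true y<z | ≤ᵇ-true (<⇒≤ x<y) | ≤ᵇ-true (<⇒≤ y<z) | ≤ᵇ-false x<y | ≤ᵇ-false (<-trans x<y y<z) = refl
... | tri< y<z _ _ | tri> _ _ y<x | tri< x<z _ _
  rewrite <ᵇ-true y<z | ≤ᵇ-false y<x | ≤ᵇ-true (<⇒≤ y<x) | ≤ᵇ-true (<⇒≤ x<z) | ≤ᵇ-true (<⇒≤ y<z) | ≤ᵇ-false x<z = refl
... | tri< y<z _ _ | tri> _ _ y<x | tri> _ _ z<x
  rewrite <ᵇ-true y<z | ≤ᵇ-false y<x | ≤ᵇ-true (<⇒≤ y<x) | ≤ᵇ-false z<x | ≤ᵇ-true (<⇒≤ y<z) | ≤ᵇ-true (<⇒≤ z<x) = refl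
... | tri> _ _ z<y | tri< x<y _ _ | _
  rewrite <ᵇ-false (<⇒≤ z<y) | ≤ᵇ-false z<y | ∧-zeroʳ (x ≤ᵇ y) | ≤ᵇ-false x<y = refl
... | tri> _ _ z<y | tri> _ _ y<x | _
  rewrite <ᵇ-false (<⇒≤ z<y) | ≤ᵇ-false z<y | ∧-zeroʳ (x ≤ᵇ y) | ≤ᵇ-true (<⇒≤ y<x) | ≤ᵇ-false (<-trans z<y y<x) = refl

-- Each zero-nim triple with y < z is x together with {y, z}, where x can sit in any of three places.
sortedZeroNim-insert : ∀ K x y z → 1 ≤ x → 1 ≤ y → 1 ≤ z →
  𝟙 ((y <ᵇ z) ∧ zeroNim≤ K x y z) ≡ 𝟙 (isZeroNim K (x , y , z)) + 𝟙 (isZeroNim K (y , x , z)) + 𝟙 (isZeroNim K (y , z , x))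
sortedZeroNim-insert K x y z 1≤x 1≤y 1≤z
  rewrite zeroNim≤-swap₁₂ K x y z | zeroNim≤-rotate K x y z = byZeroNim (zeroNim≤ K x y z) refl
  where
  byZeroNim : ∀ b → zeroNim≤ K x y z ≡ b →
    𝟙 ((y <ᵇ z) ∧ b) ≡ 𝟙 ((x ≤ᵇ y) ∧ (y ≤ᵇ z) ∧ b) + 𝟙 ((y ≤ᵇ x) ∧ (x ≤ᵇ z) ∧ b) + 𝟙 ((y ≤ᵇ z) ∧ (z ≤ᵇ x) ∧ b)
  byZeroNim false _
    rewrite ∧-zeroʳ (y <ᵇ z) | ∧-zeroʳ (y ≤ᵇ z) | ∧-zeroʳ (x ≤ᵇ z) | ∧-zeroʳ (z ≤ᵇ x)
          | ∧-zeroʳ (x ≤ᵇ y) | ∧-zeroʳ (y ≤ᵇ x) | ∧-zeroʳ (y ≤ᵇ z) = refl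
  byZeroNim true isZero
    rewrite ∧-identityʳ (y <ᵇ z) | ∧-identityʳ (y ≤ᵇ z) | ∧-identityʳ (x ≤ᵇ z) | ∧-identityʳ (z ≤ᵇ x)
    with zeroNim-distinct 1≤x 1≤y 1≤z ([a⊕b]⊕c≡0⇒a⊕b≡c x y z (proj₂ (Equivalence.to (T-∧ {x + y + z ≤ᵇ K}) (subst T (sym isZero) _))))
  ... | x≢y , y≢z , x≢z = 𝟙-insert x y z x≢y y≢z x≢z

#sortedZeroNim : ℕ → ℕ → ℕ
#sortedZeroNim N K = ∑³ N (λ i j k → 𝟙 (isZeroNim K (suc i , suc j , suc k)))

#zeroNimPairs : ℕ → ℕ → ℕ
#zeroNimPairs N K = ∑³ N (λ i j k → 𝟙 ((suc j <ᵇ suc k) ∧ zeroNim≤ K (suc i) (suc j) (suc k)))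

#zeroNimPairs≡3*#sortedZeroNim : ∀ N K → #zeroNimPairs N K ≡ 3 * #sortedZeroNim N K
#zeroNimPairs≡3*#sortedZeroNim N K = begin
  #zeroNimPairs N K
    ≡⟨ ∑³-cong N (λ i j k → sortedZeroNim-insert K (suc i) (suc j) (suc k) (s≤s z≤n) (s≤s z≤n) (s≤s z≤n)) ⟩
  ∑³ N (λ i j k → Z i j k + Z j i k + Z j k i)
    ≡⟨ ∑³-distrib-+ N _ _ ⟩
  ∑³ N (λ i j k → Z i j k + Z j i k) + ∑³ N (λ i j k → Z j k i)
    ≡⟨ cong₂ _+_ (trans (∑³-distrib-+ N _ _) (cong (∑³ N Z +_) (∑³-swap₁₂ N Z))) (∑³-rotate N Z) ⟩
  ∑³ N Z + ∑³ N Z + ∑³ N Z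
    ≡⟨ thrice (∑³ N Z) ⟩
  3 * #sortedZeroNim N K ∎
  where
  open ≡-Reasoning
  Z : ℕ → ℕ → ℕ → ℕ
  Z i j k = 𝟙 (isZeroNim K (suc i , suc j , suc k))
  thrice : ∀ a → a + a + a ≡ 3 * a
  thrice = solve-∀

zeroNim= : ℕ → ℕ → ℕ → ℕ → Bool
zeroNim= S x y z = (x + y + z ≡ᵇ S) ∧ ((x ⊕ y) ⊕ z ≡ᵇ 0)

#zeroNimPairs= : ℕ → ℕ → ℕ
#zeroNimPairs= N S = ∑³ N (λ i j k → 𝟙 ((suc j <ᵇ suc k) ∧ zeroNim= S (suc i) (suc j) (suc k)))

𝟙-≤ᵇ-suc : ∀ a K → 𝟙 (a ≤ᵇ suc K) ≡ 𝟙 (a ≤ᵇ K) + 𝟙 (a ≡ᵇ suc K)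
𝟙-≤ᵇ-suc a K with <-cmp a (suc K)
... | tri< a<1+K _ _ rewrite ≤ᵇ-true (<⇒≤ a<1+K) | ≤ᵇ-true (≤-pred a<1+K) | ≡ᵇ-false (<⇒≢ a<1+K) = refl
... | tri≈ _ refl _  rewrite ≤ᵇ-true (≤-refl {suc K}) | ≤ᵇ-false (n<1+n K) | ≡ᵇ-refl K = refl
... | tri> _ _ 1+K<a rewrite ≤ᵇ-false 1+K<a | ≤ᵇ-false (<-trans (n<1+n K) 1+K<a) | ≡ᵇ-false (>⇒≢ 1+K<a) = refl

#zeroNimPairs-suc : ∀ N K → #zeroNimPairs N (suc K) ≡ #zeroNimPairs N K + #zeroNimPairs= N (suc K)
#zeroNimPairs-suc N K = trans (∑³-cong N (λ i j k → split (suc j <ᵇ suc k) (suc i ⊕ suc j ⊕ suc k ≡ᵇ 0) (𝟙-≤ᵇ-suc (suc i + suc j + suc k) K)))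
                              (∑³-distrib-+ N _ _)
  where
  split : ∀ c d {u v w} → 𝟙 u ≡ 𝟙 v + 𝟙 w → 𝟙 (c ∧ (u ∧ d)) ≡ 𝟙 (c ∧ (v ∧ d)) + 𝟙 (c ∧ (w ∧ d))
  split false d             _ = refl
  split true  false {u} {v} {w} _ rewrite ∧-zeroʳ u | ∧-zeroʳ v | ∧-zeroʳ w = refl
  split true  true  {u} {v} {w} u≡v+w rewrite ∧-identityʳ u | ∧-identityʳ v | ∧-identityʳ w = u≡v+w

#zeroNimPairs-0 : ∀ N → #zeroNimPairs N 0 ≡ 0
#zeroNimPairs-0 N = ∑-zero N (λ i _ → ∑-zero N (λ j _ → ∑-zero N (λ k _ → cong 𝟙 (∧-zeroʳ (suc j <ᵇ suc k)))))

p≡#sortedZeroNim : ∀ K → p K ≡ #sortedZeroNim K K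
p≡#sortedZeroNim K = begin
  p K
    ≡⟨ length-filterᵇ (isZeroNim K) (triples K) ⟩
  sum (map h (triples K))
    ≡⟨ sum-map-concatMap h triplesFrom r ⟩
  sum (map (λ x → sum (map h (triplesFrom x))) r)
    ≡⟨ sum-map-range1 K _ ⟩
  ∑ K (λ i → sum (map h (triplesFrom (suc i))))
    ≡⟨ ∑-cong K (λ i _ → trans (sum-map-concatMap h (triplesFrom₂ (suc i)) r) (sum-map-range1 K _)) ⟩
  ∑ K (λ i → ∑ K (λ j → sum (map h (triplesFrom₂ (suc i) (suc j)))))
    ≡⟨ ∑-cong K (λ i _ → ∑-cong K (λ j _ → trans (cong sum (sym (map-∘ r))) (sum-map-range1 K _))) ⟩
  #sortedZeroNim K K ∎
  where
  open ≡-Reasoning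
  r : List ℕ
  r = range 1 K
  h : ℕ × ℕ × ℕ → ℕ
  h t = 𝟙 (isZeroNim K t)
  triplesFrom₂ : ℕ → ℕ → List (ℕ × ℕ × ℕ)
  triplesFrom₂ x y = map (λ z → (x , y , z)) r
  triplesFrom : ℕ → List (ℕ × ℕ × ℕ)
  triplesFrom x = concatMap (triplesFrom₂ x) r

doubleSum-suc : ∀ K → doubleSum (suc K) ≡ doubleSum K + innerSum (suc K)
doubleSum-suc zero          = refl
doubleSum-suc (suc zero)    = refl
doubleSum-suc (suc (suc m)) = begin
  doubleSum (3 + m)                                 ≡⟨ sum-map-range 3 (suc m) innerSum ⟩
  ∑ m (λ i → innerSum (i + 3)) + innerSum (m + 3)   ≡⟨ cong₂ _+_ (sum-map-range 3 m innerSum) (cong innerSum (+-comm 3 m)) ⟨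
  doubleSum (2 + m) + innerSum (3 + m)              ∎
  where open ≡-Reasoning

+-≡ᵇ-∸ : ∀ S x y z → x ≤ S → (x + y + z ≡ᵇ S) ≡ (y + z ≡ᵇ S ∸ x)
+-≡ᵇ-∸ S x y z x≤S = T-ext
  (λ t → ≡⇒≡ᵇ _ _ (trans (sym (m+n∸m≡n x (y + z))) (cong (_∸ x) (trans (sym (+-assoc x y z)) (≡ᵇ⇒≡ _ _ t)))))
  (λ t → ≡⇒≡ᵇ _ _ (trans (+-assoc x y z) (trans (cong (x +_) (≡ᵇ⇒≡ _ _ t)) (m+[n∸m]≡n x≤S))))

S<1+i+1+j+1+k : ∀ {S i j k} → S ∸ 2 ≤ i → S < suc i + suc j + suc k
S<1+i+1+j+1+k {S} {i} {j} {k} S∸2≤i = begin-strict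
  S                       ≤⟨ m≤n+m∸n S 2 ⟩
  2 + (S ∸ 2)             ≤⟨ +-monoʳ-≤ 2 S∸2≤i ⟩
  2 + i                   <⟨ s≤s (s≤s (s≤s (m≤m+n i (j + k)))) ⟩
  3 + (i + (j + k))       ≡⟨ regroup i j k ⟨
  suc i + suc j + suc k   ∎
  where
  open ≤-Reasoning
  regroup : ∀ i j k → suc i + suc j + suc k ≡ 3 + (i + (j + k))
  regroup = solve-∀

#zeroNimPairs=≡innerSum : ∀ N S → S ≤ N → #zeroNimPairs= N S ≡ innerSum S
#zeroNimPairs=≡innerSum N S S≤N = begin
  ∑ N C                                          ≡⟨ ∑-vanishing-tail (S ∸ 2) N C (≤-trans (m∸n≤m S 2) S≤N) (λ i S∸2≤i _ → ∑-zero N (λ j _ → ∑-zero N (λ k _ → tooBig i j k S∸2≤i))) ⟩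
  ∑ (S ∸ 2) C                                    ≡⟨ ∑-cong (S ∸ 2) (λ i i<S∸2 → C≡f i (≤-trans i<S∸2 (m∸n≤m S 2))) ⟩
  ∑ (S ∸ 2) (λ i → f (ℤ.+ (S ∸ suc i)) (suc i))  ≡⟨ sum-map-range1 (S ∸ 2) _ ⟨
  innerSum S                                     ∎
  where
  open ≡-Reasoning
  C : ℕ → ℕ
  C i = ∑² N (λ j k → 𝟙 ((suc j <ᵇ suc k) ∧ zeroNim= S (suc i) (suc j) (suc k)))
  tooBig : ∀ i j k → S ∸ 2 ≤ i → 𝟙 ((suc j <ᵇ suc k) ∧ zeroNim= S (suc i) (suc j) (suc k)) ≡ 0
  tooBig i j k S∸2≤i rewrite ≡ᵇ-false {suc i + suc j + suc k} {S} (>⇒≢ (S<1+i+1+j+1+k S∸2≤i)) = cong 𝟙 (∧-zeroʳ (suc j <ᵇ suc k))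
  C≡f : ∀ i → suc i ≤ S → C i ≡ f (ℤ.+ (S ∸ suc i)) (suc i)
  C≡f i 1+i≤S = trans (∑²-cong N (λ j k → cong (λ b → 𝟙 ((suc j <ᵇ suc k) ∧ b))
                        (cong₂ _∧_ (+-≡ᵇ-∸ S (suc i) (suc j) (suc k) 1+i≤S) (zeroXor-as-pair (suc i) (suc j) (suc k)))))
                      (#positiveIncreasingSumXor≡f N (S ∸ suc i) (suc i) (s≤s z≤n) (≤-trans (m∸n≤m S (suc i)) S≤N))

#zeroNimPairs≡doubleSum : ∀ N K → K ≤ N → #zeroNimPairs N K ≡ doubleSum K
#zeroNimPairs≡doubleSum N zero    _   = #zeroNimPairs-0 N
#zeroNimPairs≡doubleSum N (suc K) K<N = begin
  #zeroNimPairs N (suc K)                         ≡⟨ #zeroNimPairs-suc N K ⟩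
  #zeroNimPairs N K + #zeroNimPairs= N (suc K)    ≡⟨ cong₂ _+_ (#zeroNimPairs≡doubleSum N K (<⇒≤ K<N)) (#zeroNimPairs=≡innerSum N (suc K) K<N) ⟩
  doubleSum K + innerSum (suc K)                  ≡⟨ doubleSum-suc K ⟨
  doubleSum (suc K)                               ∎
  where open ≡-Reasoning

3*p≡doubleSum : ∀ K → 3 * p K ≡ doubleSum K
3*p≡doubleSum K = begin
  3 * p K                  ≡⟨ cong (3 *_) (p≡#sortedZeroNim K) ⟩
  3 * #sortedZeroNim K K   ≡⟨ #zeroNimPairs≡3*#sortedZeroNim K K ⟨
  #zeroNimPairs K K        ≡⟨ #zeroNimPairs≡doubleSum K K ≤-refl ⟩
  doubleSum K              ∎
  where open ≡-Reasoning

ℕ→ℚ : ℕ → ℚ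
ℕ→ℚ n = (ℤ.+ n) ℚ./ 1

ℕ→ℚ≡mkℚ : ∀ n → ℕ→ℚ n ≡ mkℚ (ℤ.+ n) 0 (λ (_ , d∣1) → ∣1⇒≡1 d∣1)
ℕ→ℚ≡mkℚ n = ℚP.normalize-coprime (λ (_ , d∣1) → ∣1⇒≡1 d∣1)

ℕ→ℚ-+ : ∀ a b → ℕ→ℚ a ℚ.+ ℕ→ℚ b ≡ ℕ→ℚ (a + b)
ℕ→ℚ-+ a b rewrite ℕ→ℚ≡mkℚ a | ℕ→ℚ≡mkℚ b =
  cong (ℚ._/ 1) (trans (cong₂ ℤ._+_ (ℤP.*-identityʳ (ℤ.+ a)) (ℤP.*-identityʳ (ℤ.+ b))) (sym (ℤP.pos-+ a b)))

ℕ→ℚ-* : ∀ a b → ℕ→ℚ a ℚ.* ℕ→ℚ b ≡ ℕ→ℚ (a * b)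
ℕ→ℚ-* a b rewrite ℕ→ℚ≡mkℚ a | ℕ→ℚ≡mkℚ b = cong (ℚ._/ 1) (sym (ℤP.pos-* a b))

third*[3*a]≡a : ∀ a → third ℚ.* ℕ→ℚ (3 * a) ≡ ℕ→ℚ a
third*[3*a]≡a a = begin
  third ℚ.* ℕ→ℚ (3 * a)          ≡⟨ cong (third ℚ.*_) (ℕ→ℚ-* 3 a) ⟨
  third ℚ.* (ℕ→ℚ 3 ℚ.* ℕ→ℚ a)    ≡⟨ ℚP.*-assoc third (ℕ→ℚ 3) (ℕ→ℚ a) ⟨
  (third ℚ.* ℕ→ℚ 3) ℚ.* ℕ→ℚ a    ≡⟨ ℚP.*-identityˡ (ℕ→ℚ a) ⟩
  ℕ→ℚ a                          ∎
  where open ≡-Reasoning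

sumℚ-map-q : ∀ xs → sumℚ (map q xs) ≡ third ℚ.* ℕ→ℚ (sum (map innerSum xs))
sumℚ-map-q []       = refl
sumℚ-map-q (S ∷ xs) = begin
  q S ℚ.+ sumℚ (map q xs)
    ≡⟨ cong (q S ℚ.+_) (sumℚ-map-q xs) ⟩
  third ℚ.* ℕ→ℚ (innerSum S) ℚ.+ third ℚ.* ℕ→ℚ (sum (map innerSum xs))
    ≡⟨ ℚP.*-distribˡ-+ third (ℕ→ℚ (innerSum S)) (ℕ→ℚ (sum (map innerSum xs))) ⟨
  third ℚ.* (ℕ→ℚ (innerSum S) ℚ.+ ℕ→ℚ (sum (map innerSum xs)))
    ≡⟨ cong (third ℚ.*_) (ℕ→ℚ-+ (innerSum S) (sum (map innerSum xs))) ⟩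
  third ℚ.* ℕ→ℚ (sum (map innerSum (S ∷ xs))) ∎
  where open ≡-Reasoning

lemma7p5 : (K : ℕ) → K ≥ 3 →
    ((ℤ.+ p K) ℚ./ 1 ≡ third ℚ.* ((ℤ.+ doubleSum K) ℚ./ 1))
      × ((ℤ.+ p K) ℚ./ 1 ≡ sumℚ (map q (range 3 (K ∸ 2))))
lemma7p5 K _ = p≡third*doubleSum , trans p≡third*doubleSum (sym (sumℚ-map-q (range 3 (K ∸ 2))))
  where
  p≡third*doubleSum : ℕ→ℚ (p K) ≡ third ℚ.* ℕ→ℚ (doubleSum K)
  p≡third*doubleSum = trans (sym (third*[3*a]≡a (p K))) (cong (λ t → third ℚ.* ℕ→ℚ t) (3*p≡doubleSum K))
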